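{- Let $n\ge 4$ and $b\in[2,n-2]$. There is a bijection from the set of permutations $\pi$ of $[n]$ that contain exactly two occurrences of $321$, where these two occurrences both have middle letter $b$ and also have the same last letter, to the Cartesian product of $\{\rho:\ \rho\text{ a }321\text{ -avoiding permutation of }[b+1]\text{ with last entry}\le b-1\}$ and $\{\sigma:\ \sigma\text{ a }321\text{ -avoiding permutation of }[n-b+1]\text{ in which the letter }1\text{ occurs at position }3\text{ or later}\}$.
   Context: A permutation of $[n]$ is a word $\pi_1\cdots\pi_n$. An occurrence of $321$ in $\pi$ is a triple of positions $i_1<i_2<i_3$ with $\pi_{i_1}>\pi_{i_2}>\pi_{i_3}$; its first, middle and last letters are $\pi_{i_1},\pi_{i_2},\pi_{i_3}$. A permutation is $321$-avoiding if it has no occurrence of $321$. -}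

module Defs where

open import Data.Nat using (ℕ; zero; suc; _+_; _∸_; _≤_)
open import Data.Fin using (Fin; toℕ) renaming (_<_ to _<ᶠ_; _<?_ to _<?ᶠ_)
open import Data.Vec using (Vec; lookup; last)
open import Data.List using (List; []; _∷_; filter; concatMap; allFin)
open import Data.Product using (Σ; ∃; ∃-syntax; _×_; _,_)
open import Relation.Binary.PropositionalEquality using (_≡_)
open import Relation.Nullary using (¬_)
open import Relation.Nullary.Decidable using (_×-dec_)
open import Data.Refinement using (Refinement)

-- A word of length n over the alphabet Fin n; the entry x : Fin n
-- stands for the letter (toℕ x + 1) of [n] = {1,…,n}.
-- Position i : Fin n stands for position (toℕ i + 1).
Word : ℕ → Set
Word n = Vec (Fin n) n

letter : ∀ {n} → Fin n → ℕ
letter x = suc (toℕ x)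

-- A word π₁⋯πₙ over [n] is a permutation of [n] iff it is injective
-- (an injective map [n] → [n] is a bijection).
IsPermutation : ∀ {n} → Word n → Set
IsPermutation {n} π = ∀ (i j : Fin n) → lookup π i ≡ lookup π j → i ≡ j

Occ321 : ∀ {n} → Word n → Fin n → Fin n → Fin n → Set
Occ321 π i j k =
  (i <ᶠ j × j <ᶠ k) × (lookup π j <ᶠ lookup π i × lookup π k <ᶠ lookup π j)

occurrences321 : ∀ {n} → Word n → List (Fin n × Fin n × Fin n)
occurrences321 {n} π =
  filter (λ { (i , j , k) → ((i <?ᶠ j) ×-dec (j <?ᶠ k))
                        ×-dec ((lookup π j <?ᶠ lookup π i) ×-dec (lookup π k <?ᶠ lookup π j)) })
    (concatMap (λ i → concatMap (λ j → Data.List.map (λ k → (i , j , k)) (allFin n)) (allFin n)) (allFin n))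

Avoids321 : ∀ {n} → Word n → Set
Avoids321 {n} π = ∀ (i j k : Fin n) → ¬ Occ321 π i j k

TwoOcc : ℕ → ℕ → Set
TwoOcc n b = Refinement (Word n) λ π → IsPermutation π ×
  (∃[ i₁ ] ∃[ j₁ ] ∃[ k₁ ] ∃[ i₂ ] ∃[ j₂ ] ∃[ k₂ ]
     (occurrences321 π ≡ (i₁ , j₁ , k₁) ∷ (i₂ , j₂ , k₂) ∷ [])
     × letter (lookup π j₁) ≡ b × letter (lookup π j₂) ≡ b
     × lookup π k₁ ≡ lookup π k₂)

RhoSet : ℕ → Set
RhoSet b = Refinement (Word (suc b)) λ ρ → IsPermutation ρ × Avoids321 ρ × letter (last ρ) ≤ b ∸ 1

SigmaSet : ℕ → ℕ → Set
SigmaSet n b = Refinement (Word (n ∸ b + 1)) λ σ → IsPermutation σ × Avoids321 σ ×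
  (∃[ p ] letter (lookup σ p) ≡ 1 × 3 ≤ suc (toℕ p))

-- Count letters and positions from 0, write the middle letter b as B + 1 and n as (B + 1) + (s + 1).
-- Let (i₁, j, k) and (i₂, j, k) be the two occurrences of 321 in π, so π j = B. A letter in front of j
-- that exceeds B starts an occurrence (·, j, k), so it is π i₁ or π i₂, and π i₁ < π i₂ in position
-- order, since otherwise (i₁, i₂, j) would be a third occurrence; a letter after j below B ends an
-- occurrence (i₁, j, ·), so it is π k. Hence ρ, the pattern of π on the positions in front of j followed
-- by k, and σ, the pattern of π on i₁, i₂ followed by the positions after j, are permutations, and
-- counting their letters forces j = B + 1. A 321 in ρ or σ would be one in π with middle position
-- other than j, and ρ ends in π k < B while π k becomes σ's letter 0, at position k - j + 1 ≥ 2.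
-- Conversely, gluing such ρ and σ back together produces exactly the two occurrences
-- (p, B + 1, B + z) with ρ p ∈ {B, B + 1} and σ z = 0, and the two constructions are inverse.

module Submission where

open import Defs
open import Data.Nat
open import Data.Nat.Properties
open import Data.Fin as Fin using (Fin; zero; suc; toℕ; fromℕ<; punchOut)
open import Data.Fin.Properties using (toℕ-injective; toℕ<n; toℕ-fromℕ<; pigeonhole; punchOut-injective; any?)
open import Data.Vec using (Vec; []; _∷_; lookup; last; tabulate)
open import Data.Vec.Properties using (lookup∘tabulate)
import Data.Vec.Properties as Vec
open import Data.List using (List; []; _∷_; map; concatMap; allFin)
open import Data.List.Membership.Propositional using (_∈_)
open import Data.List.Membership.Propositional.Properties
  using (∈-filter⁻; ∈-filter⁺; ∈-concatMap⁺; ∈-concatMap⁻; ∈-allFin; ∈-map⁺; ∈-map⁻)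
open import Data.List.Relation.Unary.Any using (here; there; satisfied)
import Data.List.Relation.Unary.Any as Any
open import Data.List.Relation.Unary.All using (_∷_; lookupAny)
open import Data.List.Relation.Unary.AllPairs using ([]; _∷_)
open import Data.List.Relation.Unary.Unique.Propositional using (Unique)
import Data.List.Relation.Unary.Unique.Propositional.Properties as Unique
open import Data.Product using (∃; ∃₂; ∃-syntax; _×_; _,_; proj₁; proj₂)
import Data.Product.Properties as Product
open import Data.Sum using (_⊎_; inj₁; inj₂)
import Data.Sum
open import Data.Unit using (⊤; tt)
open import Data.Empty using (⊥-elim)
open import Data.Refinement using (Refinement; _,_; value-injective)
open import Data.Irrelevant using ([_])
open import Function using (_∘_)
open import Function.Bundles using (_⤖_; mk↔ₛ′)
open import Function.Properties.Inverse using (↔⇒⤖)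
open import Relation.Nullary using (¬_; yes; no)
open import Relation.Nullary.Decidable using (recompute)
open import Relation.Binary.Definitions using (DecidableEquality; tri<; tri≈; tri>)
open import Relation.Binary.PropositionalEquality

-- Words as functions on ℕ

AgreeBelow : ℕ → (ℕ → ℕ) → (ℕ → ℕ) → Set
AgreeBelow m f g = ∀ p → p < m → f p ≡ g p

entry : ∀ {m k} → Vec (Fin m) k → ℕ → ℕ
entry []       _       = 0
entry (x ∷ _)  zero    = toℕ x
entry (_ ∷ xs) (suc p) = entry xs p

entry-lookup : ∀ {m k} (v : Vec (Fin m) k) (i : Fin k) → entry v (toℕ i) ≡ toℕ (lookup v i)
entry-lookup (_ ∷ _) zero    = refl
entry-lookup (_ ∷ v) (suc i) = entry-lookup v i

entry-fromℕ< : ∀ {m k p} (v : Vec (Fin m) k) (p<k : p < k) → entry v p ≡ toℕ (lookup v (fromℕ< p<k))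
entry-fromℕ< v p<k = trans (cong (entry v) (sym (toℕ-fromℕ< p<k))) (entry-lookup v (fromℕ< p<k))

-- Past the end of the word the entry is the junk value 0, so the bound holds everywhere.
entry-< : ∀ {m k} (v : Vec (Fin (suc m)) k) p → entry v p < suc m
entry-< []      _       = z<s
entry-< (x ∷ _) zero    = toℕ<n x
entry-< (_ ∷ v) (suc p) = entry-< v p

entry-last : ∀ {m k} (v : Vec (Fin m) (suc k)) → toℕ (last v) ≡ entry v k
entry-last (_ ∷ [])    = refl
entry-last (_ ∷ y ∷ v) = entry-last (y ∷ v)

entry-injective : ∀ {m k} (u v : Vec (Fin m) k) → AgreeBelow k (entry u) (entry v) → u ≡ v
entry-injective []      []      _     = refl
entry-injective (x ∷ u) (y ∷ v) agree =
  cong₂ _∷_ (toℕ-injective (agree 0 z<s)) (entry-injective u v (λ p p<k → agree (suc p) (s<s p<k)))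

clamp : ∀ m → ℕ → Fin (suc m)
clamp m x = fromℕ< (s≤s (m⊓n≤n x m))

tabulateℕ : ∀ {m} k → (ℕ → ℕ) → Vec (Fin (suc m)) k
tabulateℕ _ f = tabulate (λ i → clamp _ (f (toℕ i)))

entry-tabulateℕ : ∀ {m k p} (f : ℕ → ℕ) → p < k → f p < suc m → entry (tabulateℕ {m} k f) p ≡ f p
entry-tabulateℕ {m} {k} {p} f p<k fp<1+m = begin
  entry (tabulateℕ {m} k f) p                ≡⟨ entry-fromℕ< (tabulateℕ {m} k f) p<k ⟩
  toℕ (lookup (tabulateℕ {m} k f) (fromℕ< p<k)) ≡⟨ cong toℕ (lookup∘tabulate _ (fromℕ< p<k)) ⟩
  toℕ (clamp m (f (toℕ (fromℕ< p<k))))         ≡⟨ toℕ-fromℕ< _ ⟩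
  f (toℕ (fromℕ< p<k)) ⊓ m                     ≡⟨ cong (λ q → f q ⊓ m) (toℕ-fromℕ< p<k) ⟩
  f p ⊓ m                                      ≡⟨ m≤n⇒m⊓n≡m (s≤s⁻¹ fp<1+m) ⟩
  f p                                          ∎
  where open ≡-Reasoning

InjectiveOn : ℕ → (ℕ → ℕ) → Set
InjectiveOn m f = ∀ p q → p < m → q < m → f p ≡ f q → p ≡ q

Occurs321 : (ℕ → ℕ) → ℕ → ℕ → ℕ → Set
Occurs321 f p q r = (p < q × q < r) × (f q < f p × f r < f q)

Avoids321Below : ℕ → (ℕ → ℕ) → Set
Avoids321Below m f = ∀ p q r → r < m → ¬ Occurs321 f p q r

module _ {m : ℕ} {f g : ℕ → ℕ} (f≗g : AgreeBelow m f g) where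

  injectiveOn-agree : InjectiveOn m f → InjectiveOn m g
  injectiveOn-agree inj p q p<m q<m gp≡gq =
    inj p q p<m q<m (trans (f≗g p p<m) (trans gp≡gq (sym (f≗g q q<m))))

  occurs321-agree : ∀ {p q r} → r < m → Occurs321 f p q r → Occurs321 g p q r
  occurs321-agree {p} {q} {r} r<m ((p<q , q<r) , (fq<fp , fr<fq)) =
    (p<q , q<r) , (subst₂ _<_ (f≗g q q<m) (f≗g p p<m) fq<fp , subst₂ _<_ (f≗g r r<m) (f≗g q q<m) fr<fq)
    where
    q<m = <-trans q<r r<m
    p<m = <-trans p<q q<m

avoids321-agree : ∀ {m f g} → AgreeBelow m f g → Avoids321Below m f → Avoids321Below m g
avoids321-agree f≗g avoid p q r r<m occ = avoid p q r r<m (occurs321-agree (λ x x<m → sym (f≗g x x<m)) r<m occ)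

module _ {m : ℕ} (π : Word m) where

  isPermutation⇒injectiveOn : IsPermutation π → InjectiveOn m (entry π)
  isPermutation⇒injectiveOn perm p q p<m q<m πp≡πq = begin
    p                    ≡⟨ toℕ-fromℕ< p<m ⟨
    toℕ (fromℕ< p<m)     ≡⟨ cong toℕ (perm _ _ (toℕ-injective lookups-equal)) ⟩
    toℕ (fromℕ< q<m)     ≡⟨ toℕ-fromℕ< q<m ⟩
    q                    ∎
    where
    open ≡-Reasoning
    lookups-equal = trans (sym (entry-fromℕ< π p<m)) (trans πp≡πq (entry-fromℕ< π q<m))

  injectiveOn⇒isPermutation : InjectiveOn m (entry π) → IsPermutation π
  injectiveOn⇒isPermutation inj i j πi≡πj = toℕ-injective (inj (toℕ i) (toℕ j) (toℕ<n i) (toℕ<n j)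
    (trans (entry-lookup π i) (trans (cong toℕ πi≡πj) (sym (entry-lookup π j)))))

  occ321⇒occurs321 : ∀ {i j k} → Occ321 π i j k → Occurs321 (entry π) (toℕ i) (toℕ j) (toℕ k)
  occ321⇒occurs321 {i} {j} {k} (positions , (πj<πi , πk<πj)) = positions ,
    (subst₂ _<_ (sym (entry-lookup π j)) (sym (entry-lookup π i)) πj<πi ,
     subst₂ _<_ (sym (entry-lookup π k)) (sym (entry-lookup π j)) πk<πj)

  occurs321⇒occ321 : ∀ {i j k p q r} → toℕ i ≡ p → toℕ j ≡ q → toℕ k ≡ r →
                     Occurs321 (entry π) p q r → Occ321 π i j k
  occurs321⇒occ321 {i} {j} {k} refl refl refl (positions , (πj<πi , πk<πj)) = positions ,
    (subst₂ _<_ (entry-lookup π j) (entry-lookup π i) πj<πi ,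
     subst₂ _<_ (entry-lookup π k) (entry-lookup π j) πk<πj)

  occurs321⇒occ321ᶠ : ∀ {p q r} (p<m : p < m) (q<m : q < m) (r<m : r < m) →
                      Occurs321 (entry π) p q r → Occ321 π (fromℕ< p<m) (fromℕ< q<m) (fromℕ< r<m)
  occurs321⇒occ321ᶠ p<m q<m r<m = occurs321⇒occ321 (toℕ-fromℕ< p<m) (toℕ-fromℕ< q<m) (toℕ-fromℕ< r<m)

  avoids321⇒avoids321Below : Avoids321 π → Avoids321Below m (entry π)
  avoids321⇒avoids321Below avoid p q r r<m occ@((p<q , q<r) , _) =
    avoid _ _ _ (occurs321⇒occ321ᶠ (<-trans p<q q<m) q<m r<m occ)
    where q<m = <-trans q<r r<m

  avoids321Below⇒avoids321 : Avoids321Below m (entry π) → Avoids321 π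
  avoids321Below⇒avoids321 avoid i j k occ = avoid _ _ _ (toℕ<n k) (occ321⇒occurs321 occ)

injectiveOn⇒≤ : ∀ {m m'} (f : ℕ → ℕ) → (∀ p → p < m → f p < m') → InjectiveOn m f → m ≤ m'
injectiveOn⇒≤ {m} {m'} f f< inj with m ≤? m'
... | yes m≤m' = m≤m'
... | no m≰m' with pigeonhole (≰⇒> m≰m') (λ i → fromℕ< (f< (toℕ i) (toℕ<n i)))
...   | i , j , i<j , fi≡fj = ⊥-elim (<-irrefl (inj _ _ (toℕ<n i) (toℕ<n j) values-equal) i<j)
  where
  values-equal = trans (sym (toℕ-fromℕ< _)) (trans (cong toℕ fi≡fj) (toℕ-fromℕ< _))

-- A missed value y would let punchOut y squeeze F injectively into Fin m.
injective⇒surjective : ∀ {m} (F : Fin m → Fin m) → (∀ {i j} → F i ≡ F j → i ≡ j) → ∀ y → ∃ λ i → F i ≡ y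
injective⇒surjective {suc m} F inj y with any? (λ i → F i Fin.≟ y)
... | yes hit = hit
... | no miss = ⊥-elim (no-collision (pigeonhole (n<1+n m) (λ i → punchOut (missed i))))
  where
  missed : ∀ i → y ≢ F i
  missed i y≡Fi = miss (i , sym y≡Fi)
  no-collision : ¬ ∃₂ λ i j → i Fin.< j × punchOut (missed i) ≡ punchOut (missed j)
  no-collision (i , j , i<j , eq) = <-irrefl (cong toℕ (inj (punchOut-injective (missed i) (missed j) eq))) i<j

injectiveOn⇒surjectiveOn : ∀ {m} (f : ℕ → ℕ) → (∀ p → p < m → f p < m) → InjectiveOn m f →
                            ∀ {v} → v < m → ∃ λ p → p < m × f p ≡ v
injectiveOn⇒surjectiveOn {m} f f< inj {v} v<m with injective⇒surjective F F-injective (fromℕ< v<m)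
  where
  F : Fin m → Fin m
  F i = fromℕ< (f< (toℕ i) (toℕ<n i))
  F-injective : ∀ {i j} → F i ≡ F j → i ≡ j
  F-injective {i} {j} Fi≡Fj = toℕ-injective (inj _ _ (toℕ<n i) (toℕ<n j)
    (trans (sym (toℕ-fromℕ< _)) (trans (cong toℕ Fi≡Fj) (toℕ-fromℕ< _))))
... | i , Fi≡v = toℕ i , toℕ<n i , trans (sym (toℕ-fromℕ< _)) (trans (cong toℕ Fi≡v) (toℕ-fromℕ< v<m))

StrictlyIncreasingOn : (ℕ → Set) → (ℕ → ℕ) → Set
StrictlyIncreasingOn D f = ∀ {x y} → D x → D y → x < y → f x < f y

module _ {D : ℕ → Set} {f : ℕ → ℕ} (increasing : StrictlyIncreasingOn D f) where

  increasing⇒reflects-< : ∀ {x y} → D x → D y → f x < f y → x < y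
  increasing⇒reflects-< {x} {y} dx dy fx<fy with <-cmp x y
  ... | tri< x<y _ _ = x<y
  ... | tri≈ _ refl _ = ⊥-elim (<-irrefl refl fx<fy)
  ... | tri> _ _ y<x = ⊥-elim (<-asym fx<fy (increasing dy dx y<x))

  section-increasing : ∀ {E : ℕ → Set} {g : ℕ → ℕ} → (∀ {v} → E v → D (g v)) → (∀ {v} → E v → f (g v) ≡ v) →
                       StrictlyIncreasingOn E g
  section-increasing g∈D f∘g≡id ev ew v<w =
    increasing⇒reflects-< (g∈D ev) (g∈D ew) (subst₂ _<_ (sym (f∘g≡id ev)) (sym (f∘g≡id ew)) v<w)

  increasing⇒injective : ∀ {x y} → D x → D y → f x ≡ f y → x ≡ y
  increasing⇒injective {x} {y} dx dy fx≡fy with <-cmp x y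
  ... | tri< x<y _ _ = ⊥-elim (<⇒≢ (increasing dx dy x<y) fx≡fy)
  ... | tri≈ _ x≡y _ = x≡y
  ... | tri> _ _ y<x = ⊥-elim (<⇒≢ (increasing dy dx y<x) (sym fx≡fy))

-- The list of occurrences of 321

concatMap-unique : ∀ {A B : Set} (f : A → List B) (tag : B → A) → (∀ {x y} → y ∈ f x → tag y ≡ x) →
                   (∀ x → Unique (f x)) → ∀ {xs} → Unique xs → Unique (concatMap f xs)
concatMap-unique f tag tagged f-unique {[]}     []                    = []
concatMap-unique f tag tagged f-unique {x ∷ xs} (x∉xs ∷ xs-unique) =
  Unique.++⁺ (f-unique x) (concatMap-unique f tag tagged f-unique xs-unique) disjoint
  where
  disjoint : ∀ {y} → ¬ (y ∈ f x × y ∈ concatMap f xs)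
  disjoint (y∈fx , y∈rest) with lookupAny x∉xs (∈-concatMap⁻ f y∈rest)
  ... | x≢x' , y∈fx' = x≢x' (trans (sym (tagged y∈fx)) (tagged y∈fx'))

unique-pair : ∀ {A : Set} {xs : List A} {a b : A} → Unique xs → a ≢ b →
              (∀ {z} → z ∈ xs → z ≡ a ⊎ z ≡ b) → a ∈ xs → b ∈ xs →
              xs ≡ a ∷ b ∷ [] ⊎ xs ≡ b ∷ a ∷ []
unique-pair {xs = x ∷ []} _ a≢b _ (here refl) (here refl) = ⊥-elim (a≢b refl)
unique-pair {xs = x ∷ y ∷ []} ((x≢y ∷ _) ∷ _) _ in-ab _ _ with in-ab (here refl) | in-ab (there (here refl))
... | inj₁ refl | inj₂ refl = inj₁ refl
... | inj₂ refl | inj₁ refl = inj₂ refl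
... | inj₁ refl | inj₁ refl = ⊥-elim (x≢y refl)
... | inj₂ refl | inj₂ refl = ⊥-elim (x≢y refl)
unique-pair {xs = x ∷ y ∷ z ∷ _} ((x≢y ∷ x≢z ∷ _) ∷ (y≢z ∷ _) ∷ _) _ in-ab _ _
  with in-ab (here refl) | in-ab (there (here refl)) | in-ab (there (there (here refl)))
... | inj₁ refl | inj₁ refl | _         = ⊥-elim (x≢y refl)
... | inj₂ refl | inj₂ refl | _         = ⊥-elim (x≢y refl)
... | inj₁ refl | inj₂ refl | inj₁ refl = ⊥-elim (x≢z refl)
... | inj₁ refl | inj₂ refl | inj₂ refl = ⊥-elim (y≢z refl)
... | inj₂ refl | inj₁ refl | inj₁ refl = ⊥-elim (y≢z refl)
... | inj₂ refl | inj₁ refl | inj₂ refl = ⊥-elim (x≢z refl)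

Triple : ℕ → Set
Triple n = Fin n × Fin n × Fin n

module _ {n : ℕ} where

  private
    row : Fin n → Fin n → List (Triple n)
    row i j = map (λ k → (i , j , k)) (allFin n)

    plane : Fin n → List (Triple n)
    plane i = concatMap (row i) (allFin n)

    -- Definitionally the list that occurrences321 filters.
    triples : List (Triple n)
    triples = concatMap plane (allFin n)

    row-coordinates : ∀ {i j t} → t ∈ row i j → proj₁ t ≡ i × proj₁ (proj₂ t) ≡ j
    row-coordinates t∈ with ∈-map⁻ _ t∈
    ... | _ , _ , refl = refl , refl

    plane-coordinate : ∀ {i t} → t ∈ plane i → proj₁ t ≡ i
    plane-coordinate {i} t∈ = proj₁ (row-coordinates (proj₂ (satisfied (∈-concatMap⁻ (row i) {xs = allFin n} t∈))))

    triples-unique : Unique triples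
    triples-unique = concatMap-unique plane proj₁ plane-coordinate
      (λ i → concatMap-unique (row i) (proj₁ ∘ proj₂) (proj₂ ∘ row-coordinates)
               (λ j → Unique.map⁺ (cong (proj₂ ∘ proj₂)) (Unique.allFin⁺ n)) (Unique.allFin⁺ n))
      (Unique.allFin⁺ n)

    ∈-triples : ∀ i j k → (i , j , k) ∈ triples
    ∈-triples i j k = ∈-concatMap⁺ plane (Any.map (λ { refl →
                      ∈-concatMap⁺ (row i) (Any.map (λ { refl →
                      ∈-map⁺ _ (∈-allFin k) }) (∈-allFin j)) }) (∈-allFin i))

  module _ (π : Word n) where

    ∈-occurrences321⁻ : ∀ {i j k} → (i , j , k) ∈ occurrences321 π → Occ321 π i j k
    ∈-occurrences321⁻ t∈ = proj₂ (∈-filter⁻ _ {xs = triples} t∈)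

    ∈-occurrences321⁺ : ∀ {i j k} → Occ321 π i j k → (i , j , k) ∈ occurrences321 π
    ∈-occurrences321⁺ {i} {j} {k} occ = ∈-filter⁺ _ (∈-triples i j k) occ

    occurrences321-unique : Unique (occurrences321 π)
    occurrences321-unique = Unique.filter⁺ _ triples-unique

-- Gluing ρ and σ

raise : (B x y v : ℕ) → ℕ
raise B x y v with <-cmp v B
... | tri< _ _ _ = v
... | tri≈ _ _ _ = x
... | tri> _ _ _ = y

module _ {B x y : ℕ} where

  raise-< : ∀ {v} → v < B → raise B x y v ≡ v
  raise-< {v} v<B with <-cmp v B
  ... | tri< _ _ _   = refl
  ... | tri≈ _ v≡B _ = ⊥-elim (<⇒≢ v<B v≡B)
  ... | tri> _ _ B<v = ⊥-elim (<-asym v<B B<v)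

  raise-B : raise B x y B ≡ x
  raise-B with <-cmp B B
  ... | tri< B<B _ _ = ⊥-elim (<-irrefl refl B<B)
  ... | tri≈ _ _ _   = refl
  ... | tri> _ _ B<B = ⊥-elim (<-irrefl refl B<B)

  raise-1+B : raise B x y (suc B) ≡ y
  raise-1+B with <-cmp (suc B) B
  ... | tri< 1+B<B _ _ = ⊥-elim (<-asym 1+B<B (n<1+n B))
  ... | tri≈ _ 1+B≡B _ = ⊥-elim (<⇒≢ (n<1+n B) (sym 1+B≡B))
  ... | tri> _ _ _     = refl

  RaiseCases : ℕ → Set
  RaiseCases v = (v < B × raise B x y v ≡ v) ⊎ (v ≡ B × raise B x y v ≡ x) ⊎ (v ≡ suc B × raise B x y v ≡ y)

  raise-cases : ∀ {v} → v < 2 + B → RaiseCases v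
  raise-cases {v} v<2+B with <-cmp v B
  ... | tri< v<B _ _  = inj₁ (v<B , refl)
  ... | tri≈ _ refl _ = inj₂ (inj₁ (refl , refl))
  ... | tri> _ _ B<v with m<1+n⇒m<n∨m≡n v<2+B
  ...   | inj₁ v<1+B = ⊥-elim (<-irrefl refl (<-≤-trans B<v (s≤s⁻¹ v<1+B)))
  ...   | inj₂ refl  = inj₂ (inj₂ (refl , refl))

  raise-increasing : B ≤ x → x < y → StrictlyIncreasingOn (_< 2 + B) (raise B x y)
  raise-increasing B≤x x<y {v} {w} v<2+B w<2+B v<w with raise-cases v<2+B | raise-cases w<2+B
  ... | inj₁ (_ , rv)          | inj₁ (_ , rw)          = subst₂ _<_ (sym rv) (sym rw) v<w
  ... | inj₁ (v<B , rv)        | inj₂ (inj₁ (_ , rw))   = subst₂ _<_ (sym rv) (sym rw) (<-≤-trans v<B B≤x)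
  ... | inj₁ (v<B , rv)        | inj₂ (inj₂ (_ , rw))   = subst₂ _<_ (sym rv) (sym rw) (<-trans (<-≤-trans v<B B≤x) x<y)
  ... | inj₂ (inj₁ (_ , rv))   | inj₂ (inj₂ (_ , rw))   = subst₂ _<_ (sym rv) (sym rw) x<y
  ... | inj₂ (inj₁ (refl , _)) | inj₁ (w<B , _)         = ⊥-elim (<-asym v<w w<B)
  ... | inj₂ (inj₁ (refl , _)) | inj₂ (inj₁ (refl , _)) = ⊥-elim (<-irrefl refl v<w)
  ... | inj₂ (inj₂ (refl , _)) | inj₁ (w<B , _)         = ⊥-elim (<-asym v<w (<-trans w<B (n<1+n B)))
  ... | inj₂ (inj₂ (refl , _)) | inj₂ (inj₁ (refl , _)) = ⊥-elim (<-asym v<w (n<1+n B))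
  ... | inj₂ (inj₂ (refl , _)) | inj₂ (inj₂ (refl , _)) = ⊥-elim (<-irrefl refl v<w)

shift : (B c v : ℕ) → ℕ
shift B c zero    = c
shift B c (suc v) = suc v + B

module _ {B c : ℕ} (c<B : c < B) where

  shift-increasing : StrictlyIncreasingOn (λ _ → ⊤) (shift B c)
  shift-increasing {zero}  {suc w} _ _ _   = <-≤-trans c<B (m≤n+m B (suc w))
  shift-increasing {suc v} {suc w} _ _ v<w = +-monoˡ-< B v<w

  shift-≥ : ∀ y → c ≤ shift B c y
  shift-≥ zero    = ≤-refl
  shift-≥ (suc y) = ≤-trans (<⇒≤ c<B) (m≤n+m B (suc y))

  shift-> : ∀ {y} → y ≢ 0 → B < shift B c y
  shift-> {zero}  y≢0 = ⊥-elim (y≢0 refl)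
  shift-> {suc y} _   = m<n+m B z<s

  shift-<⇒0 : ∀ {y} → shift B c y < B → y ≡ 0
  shift-<⇒0 {zero}  _  = refl
  shift-<⇒0 {suc y} lt = ⊥-elim (<-asym lt (shift-> {suc y} λ ()))

  shift-≢B : ∀ y → shift B c y ≢ B
  shift-≢B zero    = <⇒≢ c<B
  shift-≢B (suc y) = >⇒≢ (shift-> {suc y} λ ())

  shift-∸ : ∀ y → shift B c y ∸ B ≡ y
  shift-∸ zero    = m≤n⇒m∸n≡0 (<⇒≤ c<B)
  shift-∸ (suc y) = m+n∸n≡m (suc y) B

shift-≢0 : ∀ {B c y} → y ≢ 0 → shift B c y ≡ y + B
shift-≢0 {y = zero}  y≢0 = ⊥-elim (y≢0 refl)
shift-≢0 {y = suc y} _   = refl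

data Segment (B p : ℕ) : Set where
  prefix : p < suc B → Segment B p
  middle : p ≡ suc B → Segment B p
  suffix : suc B < p → Segment B p

segment : ∀ B p → Segment B p
segment B p with <-cmp p (suc B)
... | tri< p<1+B _ _ = prefix p<1+B
... | tri≈ _ p≡1+B _ = middle p≡1+B
... | tri> _ _ 1+B<p = suffix 1+B<p

suffix-index≥2 : ∀ {B p} → suc B < p → 2 ≤ p ∸ B
suffix-index≥2 {B} {p} 1+B<p = subst (_≤ p ∸ B) (m+n∸n≡m 2 B) (∸-monoˡ-≤ B 1+B<p)

suffix⇒B≤ : ∀ {B p} → suc B < p → B ≤ p
suffix⇒B≤ {B} 1+B<p = ≤-trans (n≤1+n B) (<⇒≤ 1+B<p)

suffix-index< : ∀ B s {p} → p < suc B + suc s → p ∸ B < 2 + s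
suffix-index< zero    s         p<N       = p<N
suffix-index< (suc B) s {zero}  _         = z<s
suffix-index< (suc B) s {suc p} (s<s p<N) = suffix-index< B s p<N

-- The word of length (B+1) + (s+1) built from ρ (length B+2) and σ (length s+2), 0-based:
-- positions 0..B carry ρ with its letters B, B+1 replaced by σ₀ + B, σ₁ + B, position B+1 carries B,
-- and position B+t (t ≥ 2) carries σₜ + B, except that σ's letter 0 becomes ρ's last letter.
glue : (B : ℕ) (ρ σ : ℕ → ℕ) → ℕ → ℕ
glue B ρ σ p with <-cmp p (suc B)
... | tri< _ _ _ = raise B (σ 0 + B) (σ 1 + B) (ρ p)
... | tri≈ _ _ _ = B
... | tri> _ _ _ = shift B (ρ (suc B)) (σ (p ∸ B))

module _ {B : ℕ} {ρ σ : ℕ → ℕ} where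

  glue-prefix : ∀ {p} → p < suc B → glue B ρ σ p ≡ raise B (σ 0 + B) (σ 1 + B) (ρ p)
  glue-prefix {p} p<1+B with <-cmp p (suc B)
  ... | tri< _ _ _     = refl
  ... | tri≈ _ p≡1+B _ = ⊥-elim (<⇒≢ p<1+B p≡1+B)
  ... | tri> _ _ 1+B<p = ⊥-elim (<-asym p<1+B 1+B<p)

  glue-middle : glue B ρ σ (suc B) ≡ B
  glue-middle with <-cmp (suc B) (suc B)
  ... | tri< lt _ _ = ⊥-elim (<-irrefl refl lt)
  ... | tri≈ _ _ _  = refl
  ... | tri> _ _ gt = ⊥-elim (<-irrefl refl gt)

  glue-suffix : ∀ {p} → suc B < p → glue B ρ σ p ≡ shift B (ρ (suc B)) (σ (p ∸ B))
  glue-suffix {p} 1+B<p with <-cmp p (suc B)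
  ... | tri< p<1+B _ _ = ⊥-elim (<-asym p<1+B 1+B<p)
  ... | tri≈ _ p≡1+B _ = ⊥-elim (>⇒≢ 1+B<p p≡1+B)
  ... | tri> _ _ _     = refl

glue-cong : ∀ {B s ρ ρ′ σ σ′} → AgreeBelow (2 + B) ρ ρ′ → AgreeBelow (2 + s) σ σ′ →
            AgreeBelow (suc B + suc s) (glue B ρ σ) (glue B ρ′ σ′)
glue-cong {B} {s} {ρ} {ρ′} {σ} {σ′} ρ≗ρ′ σ≗σ′ p p<N with segment B p
... | prefix p<1+B = begin
  glue B ρ σ p                           ≡⟨ glue-prefix p<1+B ⟩
  raise B (σ 0 + B) (σ 1 + B) (ρ p)      ≡⟨ cong₂ (λ x y → raise B x y (ρ p)) (cong (_+ B) (σ≗σ′ 0 z<s)) (cong (_+ B) (σ≗σ′ 1 (s<s z<s))) ⟩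
  raise B (σ′ 0 + B) (σ′ 1 + B) (ρ p)    ≡⟨ cong (raise B _ _) (ρ≗ρ′ p (m<n⇒m<1+n p<1+B)) ⟩
  raise B (σ′ 0 + B) (σ′ 1 + B) (ρ′ p)   ≡⟨ glue-prefix p<1+B ⟨
  glue B ρ′ σ′ p                         ∎
  where open ≡-Reasoning
... | middle refl  = trans (glue-middle {B} {ρ} {σ}) (sym (glue-middle {B} {ρ′} {σ′}))
... | suffix 1+B<p = begin
  glue B ρ σ p                           ≡⟨ glue-suffix 1+B<p ⟩
  shift B (ρ (suc B)) (σ (p ∸ B))        ≡⟨ cong₂ (shift B) (ρ≗ρ′ (suc B) (n<1+n (suc B))) (σ≗σ′ (p ∸ B) (suffix-index< B s p<N)) ⟩
  shift B (ρ′ (suc B)) (σ′ (p ∸ B))      ≡⟨ glue-suffix 1+B<p ⟨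
  glue B ρ′ σ′ p                         ∎
  where open ≡-Reasoning

record RhoConditions (B : ℕ) (ρ : ℕ → ℕ) : Set where
  field
    ρ-injective : InjectiveOn (2 + B) ρ
    ρ-bounded   : ∀ p → ρ p < 2 + B
    ρ-avoids    : Avoids321Below (2 + B) ρ
    ρ-last<     : ρ (suc B) < B

record SigmaConditions (s : ℕ) (σ : ℕ → ℕ) : Set where
  field
    σ-injective : InjectiveOn (2 + s) σ
    σ-bounded   : ∀ q → σ q < 2 + s
    σ-avoids    : Avoids321Below (2 + s) σ
    zero-pos    : ℕ
    2≤zero-pos  : 2 ≤ zero-pos
    zero-pos<   : zero-pos < 2 + s
    σ-zero-pos  : σ zero-pos ≡ 0

module Gluing {B s : ℕ} {ρ σ : ℕ → ℕ} (ρ-ok : RhoConditions B ρ) (σ-ok : SigmaConditions s σ) where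
  open RhoConditions ρ-ok
  open SigmaConditions σ-ok

  N c : ℕ
  N = suc B + suc s
  c = ρ (suc B)

  π lift shiftᶜ : ℕ → ℕ
  π      = glue B ρ σ
  lift   = raise B (σ 0 + B) (σ 1 + B)
  shiftᶜ = shift B c

  π-prefix : ∀ {p} → p < suc B → π p ≡ lift (ρ p)
  π-prefix = glue-prefix

  π-middle : π (suc B) ≡ B
  π-middle = glue-middle

  π-suffix : ∀ {p} → suc B < p → π p ≡ shiftᶜ (σ (p ∸ B))
  π-suffix = glue-suffix

  σ-≢0 : ∀ {i} → i < zero-pos → σ i ≢ 0
  σ-≢0 {i} i<z σi≡0 = <⇒≢ i<z (σ-injective i zero-pos (<-trans i<z zero-pos<) zero-pos< (trans σi≡0 (sym σ-zero-pos)))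

  σ₀≢0 : σ 0 ≢ 0
  σ₀≢0 = σ-≢0 (<-≤-trans z<s 2≤zero-pos)

  σ₁≢0 : σ 1 ≢ 0
  σ₁≢0 = σ-≢0 2≤zero-pos

  σ₀<σ₁ : σ 0 < σ 1
  σ₀<σ₁ with <-cmp (σ 0) (σ 1)
  ... | tri< lt _ _ = lt
  ... | tri≈ _ eq _ = ⊥-elim (0≢1+n (σ-injective 0 1 z<s (s<s z<s) eq))
  ... | tri> _ _ gt = ⊥-elim (σ-avoids 0 1 zero-pos zero-pos< ((z<s , 2≤zero-pos) ,
                        (gt , subst (_< σ 1) (sym σ-zero-pos) (n≢0⇒n>0 σ₁≢0))))

  lift-increasing : StrictlyIncreasingOn (_< 2 + B) lift
  lift-increasing = raise-increasing (m≤n+m B (σ 0)) (+-monoˡ-< B σ₀<σ₁)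

  lift-> : ∀ {v} → B ≤ v → v < 2 + B → B < lift v
  lift-> {v} B≤v v<2+B with raise-cases {B} {σ 0 + B} {σ 1 + B} v<2+B
  ... | inj₁ (v<B , _)        = ⊥-elim (<-irrefl refl (<-≤-trans v<B B≤v))
  ... | inj₂ (inj₁ (_ , eq)) = subst (B <_) (sym eq) (m<n+m B (n≢0⇒n>0 σ₀≢0))
  ... | inj₂ (inj₂ (_ , eq)) = subst (B <_) (sym eq) (m<n+m B (n≢0⇒n>0 σ₁≢0))

  lift->⇒shift : ∀ {v} → v < 2 + B → B < lift v → (v ≡ B ⊎ v ≡ suc B) × ∃ λ i → i < 2 × lift v ≡ shiftᶜ (σ i)
  lift->⇒shift {v} v<2+B B<lift with raise-cases {B} {σ 0 + B} {σ 1 + B} v<2+B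
  ... | inj₁ (v<B , eq)         = ⊥-elim (<-asym v<B (subst (B <_) eq B<lift))
  ... | inj₂ (inj₁ (v≡B , eq))  = inj₁ v≡B , 0 , z<s , trans eq (sym (shift-≢0 σ₀≢0))
  ... | inj₂ (inj₂ (v≡1+B , eq)) = inj₂ v≡1+B , 1 , s<s z<s , trans eq (sym (shift-≢0 σ₁≢0))

  lift-<⇒≡ : ∀ {v} → v < 2 + B → lift v < B → lift v ≡ v
  lift-<⇒≡ {v} v<2+B lift<B with raise-cases {B} {σ 0 + B} {σ 1 + B} v<2+B
  ... | inj₁ (_ , eq)         = eq
  ... | inj₂ (inj₁ (_ , eq)) = ⊥-elim (<-asym lift<B (subst (B <_) (sym eq) (m<n+m B (n≢0⇒n>0 σ₀≢0))))
  ... | inj₂ (inj₂ (_ , eq)) = ⊥-elim (<-asym lift<B (subst (B <_) (sym eq) (m<n+m B (n≢0⇒n>0 σ₁≢0))))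

  lift-≢B : ∀ {v} → v < 2 + B → lift v ≢ B
  lift-≢B {v} v<2+B lift≡B with v <? B
  ... | yes v<B = <⇒≢ v<B (trans (sym (raise-< v<B)) lift≡B)
  ... | no  v≮B = >⇒≢ (lift-> (≮⇒≥ v≮B) v<2+B) lift≡B

  lift->c⇒>c : ∀ {v} → v < 2 + B → c < lift v → c < v
  lift->c⇒>c {v} v<2+B c<lift with v <? B
  ... | yes v<B = subst (c <_) (raise-< v<B) c<lift
  ... | no  v≮B = <-≤-trans ρ-last< (≮⇒≥ v≮B)

  shiftᶜ-increasing : StrictlyIncreasingOn (λ _ → ⊤) shiftᶜ
  shiftᶜ-increasing = shift-increasing ρ-last<

  N≡ : N ≡ 2 + s + B
  N≡ = cong suc (+-comm B (suc s))

  B<N : B < N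
  B<N = <-≤-trans (n<1+n B) (m≤m+n (suc B) (suc s))

  shifted-< : ∀ {y} → y < 2 + s → y + B < N
  shifted-< {y} y<2+s = subst (y + B <_) (sym N≡) (+-monoˡ-< B y<2+s)

  lift-<N : ∀ {v} → v < 2 + B → lift v < N
  lift-<N v<2+B with raise-cases {B} {σ 0 + B} {σ 1 + B} v<2+B
  ... | inj₁ (v<B , eq)       = subst (_< N) (sym eq) (<-trans v<B B<N)
  ... | inj₂ (inj₁ (_ , eq)) = subst (_< N) (sym eq) (shifted-< (σ-bounded 0))
  ... | inj₂ (inj₂ (_ , eq)) = subst (_< N) (sym eq) (shifted-< (σ-bounded 1))

  shiftᶜ-<N : ∀ {y} → y < 2 + s → shiftᶜ y < N
  shiftᶜ-<N {zero}  _     = <-trans ρ-last< B<N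
  shiftᶜ-<N {suc y} y<2+s = shifted-< y<2+s

  glue-< : ∀ p → π p < N
  glue-< p with segment B p
  ... | prefix p<1+B = subst (_< N) (sym (π-prefix p<1+B)) (lift-<N (ρ-bounded p))
  ... | middle refl  = subst (_< N) (sym π-middle) B<N
  ... | suffix 1+B<p = subst (_< N) (sym (π-suffix 1+B<p)) (shiftᶜ-<N (σ-bounded (p ∸ B)))

  glue-≥c : ∀ {r} → suc B ≤ r → c ≤ π r
  glue-≥c {r} 1+B≤r with segment B r
  ... | prefix r<1+B  = ⊥-elim (<-irrefl refl (<-≤-trans r<1+B 1+B≤r))
  ... | middle refl   = subst (c ≤_) (sym π-middle) (<⇒≤ ρ-last<)
  ... | suffix 1+B<r  = subst (c ≤_) (sym (π-suffix 1+B<r)) (shift-≥ ρ-last< (σ (r ∸ B)))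

  prefix≢suffix : ∀ {p q} → p < suc B → suc B < q → q < N → lift (ρ p) ≢ shiftᶜ (σ (q ∸ B))
  prefix≢suffix {p} {q} p<1+B 1+B<q q<N eq with B <? lift (ρ p)
  ... | yes B<lift with lift->⇒shift (ρ-bounded p) B<lift
  ...   | _ , i , i<2 , eq′ = <⇒≢ (<-≤-trans i<2 (suffix-index≥2 1+B<q))
          (σ-injective _ _ (<-≤-trans i<2 (s≤s (s≤s z≤n))) (suffix-index< B s q<N)
            (increasing⇒injective shiftᶜ-increasing {σ i} {σ (q ∸ B)} tt tt (trans (sym eq′) eq)))
  prefix≢suffix {p} {q} p<1+B 1+B<q q<N eq | no B≮lift = <⇒≢ p<1+B
    (ρ-injective _ _ (m<n⇒m<1+n p<1+B) (n<1+n (suc B)) (trans (sym (lift-<⇒≡ (ρ-bounded p) lift<B)) (trans eq σ-zero)))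
    where
    lift<B : lift (ρ p) < B
    lift<B = ≤∧≢⇒< (≮⇒≥ B≮lift) (lift-≢B (ρ-bounded p))
    σ-zero : shiftᶜ (σ (q ∸ B)) ≡ c
    σ-zero = cong shiftᶜ (shift-<⇒0 ρ-last< {σ (q ∸ B)} (subst (_< B) eq lift<B))

  glue-injective : InjectiveOn N π
  glue-injective p q p<N q<N πp≡πq with segment B p | segment B q
  ... | prefix p<1+B | prefix q<1+B = ρ-injective p q (m<n⇒m<1+n p<1+B) (m<n⇒m<1+n q<1+B)
          (increasing⇒injective lift-increasing (ρ-bounded p) (ρ-bounded q)
            (trans (sym (π-prefix p<1+B)) (trans πp≡πq (π-prefix q<1+B))))
  ... | prefix p<1+B | middle refl  = ⊥-elim (lift-≢B (ρ-bounded p) (trans (sym (π-prefix p<1+B)) (trans πp≡πq π-middle)))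
  ... | middle refl  | prefix q<1+B = ⊥-elim (lift-≢B (ρ-bounded q) (trans (sym (π-prefix q<1+B)) (trans (sym πp≡πq) π-middle)))
  ... | prefix p<1+B | suffix 1+B<q = ⊥-elim (prefix≢suffix p<1+B 1+B<q q<N
          (trans (sym (π-prefix p<1+B)) (trans πp≡πq (π-suffix 1+B<q))))
  ... | suffix 1+B<p | prefix q<1+B = ⊥-elim (prefix≢suffix q<1+B 1+B<p p<N
          (trans (sym (π-prefix q<1+B)) (trans (sym πp≡πq) (π-suffix 1+B<p))))
  ... | middle refl  | middle refl  = refl
  ... | middle refl  | suffix 1+B<q = ⊥-elim (shift-≢B ρ-last< (σ (q ∸ B)) (trans (sym (π-suffix 1+B<q)) (trans (sym πp≡πq) π-middle)))
  ... | suffix 1+B<p | middle refl  = ⊥-elim (shift-≢B ρ-last< (σ (p ∸ B)) (trans (sym (π-suffix 1+B<p)) (trans πp≡πq π-middle)))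
  ... | suffix 1+B<p | suffix 1+B<q = ∸-cancelʳ-≡ (suffix⇒B≤ 1+B<p) (suffix⇒B≤ 1+B<q)
          (σ-injective _ _ (suffix-index< B s p<N) (suffix-index< B s q<N)
            (increasing⇒injective shiftᶜ-increasing {σ (p ∸ B)} {σ (q ∸ B)} tt tt
              (trans (sym (π-suffix 1+B<p)) (trans πp≡πq (π-suffix 1+B<q)))))

  -- Abstract, so that type checking never unfolds the surjectivity witness.
  abstract
    position-of : ∀ {v} → B ≤ v → v < 2 + B → ∃ λ p → p < suc B × ρ p ≡ v
    position-of B≤v v<2+B with injectiveOn⇒surjectiveOn ρ (λ p _ → ρ-bounded p) ρ-injective v<2+B
    ... | p , p<2+B , ρp≡v with m<1+n⇒m<n∨m≡n p<2+B
    ...   | inj₁ p<1+B = p , p<1+B , ρp≡v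
    ...   | inj₂ refl  = ⊥-elim (<-irrefl ρp≡v (<-≤-trans ρ-last< B≤v))

  position-of-B position-of-1+B : ∃ λ p → p < suc B × ρ p ≡ _
  position-of-B   = position-of ≤-refl (m<n+m B z<s)
  position-of-1+B = position-of (n≤1+n B) (n<1+n (suc B))

  pB pB1 : ℕ
  pB  = proj₁ position-of-B
  pB1 = proj₁ position-of-1+B

  pB<1+B : pB < suc B
  pB<1+B = proj₁ (proj₂ position-of-B)

  pB1<1+B : pB1 < suc B
  pB1<1+B = proj₁ (proj₂ position-of-1+B)

  ρ-pB : ρ pB ≡ B
  ρ-pB = proj₂ (proj₂ position-of-B)

  ρ-pB1 : ρ pB1 ≡ suc B
  ρ-pB1 = proj₂ (proj₂ position-of-1+B)

  -- Otherwise (pB1, pB, B+1) would be an occurrence of 321 in ρ.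
  pB<pB1 : pB < pB1
  pB<pB1 with <-cmp pB pB1
  ... | tri< lt _ _ = lt
  ... | tri≈ _ eq _ = ⊥-elim (<⇒≢ (n<1+n B) (trans (sym ρ-pB) (trans (cong ρ eq) ρ-pB1)))
  ... | tri> _ _ gt = ⊥-elim (ρ-avoids pB1 pB (suc B) (n<1+n (suc B)) ((gt , pB<1+B) ,
                        (subst₂ _<_ (sym ρ-pB) (sym ρ-pB1) (n<1+n B) , subst (c <_) (sym ρ-pB) ρ-last<)))

  ρ-top⇒pB∨pB1 : ∀ {p} → p < suc B → ρ p ≡ B ⊎ ρ p ≡ suc B → p ≡ pB ⊎ p ≡ pB1
  ρ-top⇒pB∨pB1 p<1+B (inj₁ ρp≡B)   =
    inj₁ (ρ-injective _ _ (m<n⇒m<1+n p<1+B) (m<n⇒m<1+n pB<1+B) (trans ρp≡B (sym ρ-pB)))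
  ρ-top⇒pB∨pB1 p<1+B (inj₂ ρp≡1+B) =
    inj₂ (ρ-injective _ _ (m<n⇒m<1+n p<1+B) (m<n⇒m<1+n pB1<1+B) (trans ρp≡1+B (sym ρ-pB1)))

  k : ℕ
  k = B + zero-pos

  1+B<k : suc B < k
  1+B<k = subst (suc B <_) (+-comm zero-pos B) (+-monoˡ-≤ B 2≤zero-pos)

  k<N : k < N
  k<N = subst (k <_) (+-suc B (suc s)) (+-monoʳ-< B zero-pos<)

  π-k : π k ≡ c
  π-k = trans (π-suffix 1+B<k) (cong shiftᶜ (trans (cong σ (m+n∸m≡n B zero-pos)) σ-zero-pos))

  occurs321-glue⁺ : ∀ {p} → p < suc B → B ≤ ρ p → Occurs321 π p (suc B) k
  occurs321-glue⁺ p<1+B B≤ρp = (p<1+B , 1+B<k) ,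
    (subst₂ _<_ (sym π-middle) (sym (π-prefix p<1+B)) (lift-> B≤ρp (ρ-bounded _)) ,
     subst₂ _<_ (sym π-k) (sym π-middle) ρ-last<)

  π-prefix-reflects-< : ∀ {x y} → x < suc B → y < suc B → π x < π y → ρ x < ρ y
  π-prefix-reflects-< x<1+B y<1+B πx<πy = increasing⇒reflects-< lift-increasing (ρ-bounded _) (ρ-bounded _)
    (subst₂ _<_ (π-prefix x<1+B) (π-prefix y<1+B) πx<πy)

  π-suffix-reflects-< : ∀ {x y} → suc B < x → suc B < y → π x < π y → σ (x ∸ B) < σ (y ∸ B)
  π-suffix-reflects-< {x} {y} 1+B<x 1+B<y πx<πy = increasing⇒reflects-< shiftᶜ-increasing {σ (x ∸ B)} {σ (y ∸ B)} tt tt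
    (subst₂ _<_ (π-suffix 1+B<x) (π-suffix 1+B<y) πx<πy)

  -- An occurrence with middle letter in the prefix comes from one in ρ, ending at ρ's last letter if need be.
  no-321-middle-in-prefix : ∀ {p q r} → q < suc B → r < N → ¬ Occurs321 π p q r
  no-321-middle-in-prefix {p} {q} {r} q<1+B r<N ((p<q , q<r) , (πq<πp , πr<πq)) with r <? suc B
  ... | yes r<1+B = ρ-avoids p q r (m<n⇒m<1+n r<1+B) ((p<q , q<r) ,
          (π-prefix-reflects-< q<1+B (<-trans p<q q<1+B) πq<πp , π-prefix-reflects-< r<1+B q<1+B πr<πq))
  ... | no  r≮1+B = ρ-avoids p q (suc B) (n<1+n (suc B)) ((p<q , q<1+B) ,
          (π-prefix-reflects-< q<1+B (<-trans p<q q<1+B) πq<πp ,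
           lift->c⇒>c (ρ-bounded q) (≤-<-trans (glue-≥c (≮⇒≥ r≮1+B)) (subst (π r <_) (π-prefix q<1+B) πr<πq))))

  occurs321-middle-at-1+B : ∀ {p r} → r < N → Occurs321 π p (suc B) r → (p ≡ pB ⊎ p ≡ pB1) × r ≡ k
  occurs321-middle-at-1+B {p} {r} r<N ((p<1+B , 1+B<r) , (π1+B<πp , πr<π1+B)) =
    ρ-top⇒pB∨pB1 p<1+B (proj₁ (lift->⇒shift (ρ-bounded p) (subst₂ _<_ π-middle (π-prefix p<1+B) π1+B<πp))) ,
    (begin
      r              ≡⟨ m∸n+n≡m (suffix⇒B≤ 1+B<r) ⟨
      r ∸ B + B      ≡⟨ cong (_+ B) (σ-injective _ _ (suffix-index< B s r<N) zero-pos< (trans σ-at-r (sym σ-zero-pos))) ⟩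
      zero-pos + B   ≡⟨ +-comm zero-pos B ⟩
      k              ∎)
    where
    open ≡-Reasoning
    σ-at-r : σ (r ∸ B) ≡ 0
    σ-at-r = shift-<⇒0 ρ-last< {σ (r ∸ B)} (subst₂ _<_ (π-suffix 1+B<r) π-middle πr<π1+B)

  σ-source : ∀ {p q} → p < q → suc B < q → B < π p → ∃ λ i → i < q ∸ B × π p ≡ shiftᶜ (σ i)
  σ-source {p} {q} p<q 1+B<q B<πp with segment B p
  ... | prefix p<1+B with lift->⇒shift (ρ-bounded p) (subst (B <_) (π-prefix p<1+B) B<πp)
  ...   | _ , i , i<2 , eq = i , <-≤-trans i<2 (suffix-index≥2 1+B<q) , trans (π-prefix p<1+B) eq
  σ-source p<q 1+B<q B<πp | middle refl  = ⊥-elim (<-irrefl (sym π-middle) B<πp)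
  σ-source p<q 1+B<q B<πp | suffix 1+B<p = _ , ∸-monoˡ-< p<q (suffix⇒B≤ 1+B<p) , π-suffix 1+B<p

  -- The large first letter of an occurrence with middle letter in the suffix comes from σ.
  no-321-middle-in-suffix : ∀ {p q r} → suc B < q → r < N → ¬ Occurs321 π p q r
  no-321-middle-in-suffix {p} {q} {r} 1+B<q r<N ((p<q , q<r) , (πq<πp , πr<πq)) with σ-source p<q 1+B<q B<πp
    where
    1+B<r = <-trans 1+B<q q<r
    σr<σq : σ (r ∸ B) < σ (q ∸ B)
    σr<σq = π-suffix-reflects-< 1+B<r 1+B<q πr<πq
    B<πp : B < π p
    B<πp = <-trans (subst (B <_) (sym (π-suffix 1+B<q)) (shift-> ρ-last< λ σq≡0 → n≮0 (subst (σ (r ∸ B) <_) σq≡0 σr<σq))) πq<πp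
  ... | i , i<q∸B , πp≡ = σ-avoids i (q ∸ B) (r ∸ B) (suffix-index< B s r<N)
          ((i<q∸B , ∸-monoˡ-< q<r (suffix⇒B≤ 1+B<q)) ,
           (increasing⇒reflects-< shiftᶜ-increasing {σ (q ∸ B)} {σ i} tt tt (subst₂ _<_ (π-suffix 1+B<q) πp≡ πq<πp) ,
            π-suffix-reflects-< (<-trans 1+B<q q<r) 1+B<q πr<πq))

  occurs321-glue⁻ : ∀ {p q r} → r < N → Occurs321 π p q r → (p ≡ pB ⊎ p ≡ pB1) × q ≡ suc B × r ≡ k
  occurs321-glue⁻ {p} {q} {r} r<N occ = by-segment (segment B q)
    where
    by-segment : Segment B q → (p ≡ pB ⊎ p ≡ pB1) × q ≡ suc B × r ≡ k
    by-segment (prefix q<1+B) = ⊥-elim (no-321-middle-in-prefix q<1+B r<N occ)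
    by-segment (middle refl)  = let which , r≡k = occurs321-middle-at-1+B r<N occ in which , refl , r≡k
    by-segment (suffix 1+B<q) = ⊥-elim (no-321-middle-in-suffix 1+B<q r<N occ)

-- Splitting π

collapse : (B hi v : ℕ) → ℕ
collapse B hi v with v <? B
... | yes _ = v
... | no  _ with v ≟ hi
...   | yes _ = suc B
...   | no  _ = B

SmallOr : (B lo hi v : ℕ) → Set
SmallOr B lo hi v = v < B ⊎ v ≡ lo ⊎ v ≡ hi

module _ {B hi : ℕ} where

  collapse-< : ∀ {v} → v < B → collapse B hi v ≡ v
  collapse-< {v} v<B with v <? B
  ... | yes _   = refl
  ... | no  v≮B = ⊥-elim (v≮B v<B)

  collapse-hi : B ≤ hi → collapse B hi hi ≡ suc B
  collapse-hi B≤hi with hi <? B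
  ... | yes hi<B = ⊥-elim (<-irrefl refl (<-≤-trans hi<B B≤hi))
  ... | no  _ with hi ≟ hi
  ...   | yes _     = refl
  ...   | no  hi≢hi = ⊥-elim (hi≢hi refl)

  collapse-other : ∀ {v} → B ≤ v → v ≢ hi → collapse B hi v ≡ B
  collapse-other {v} B≤v v≢hi with v <? B
  ... | yes v<B = ⊥-elim (<-irrefl refl (<-≤-trans v<B B≤v))
  ... | no  _ with v ≟ hi
  ...   | yes v≡hi = ⊥-elim (v≢hi v≡hi)
  ...   | no  _    = refl

  collapse-<2+B : ∀ v → collapse B hi v < 2 + B
  collapse-<2+B v with v <? B
  ... | yes v<B = <-trans v<B (m<n+m B z<s)
  ... | no  _ with v ≟ hi
  ...   | yes _ = n<1+n (suc B)
  ...   | no  _ = m<n+m B z<s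

  module _ {lo : ℕ} (B≤lo : B ≤ lo) (lo<hi : lo < hi) where

    private
      B≤hi = ≤-trans B≤lo (<⇒≤ lo<hi)

      CollapseCases : ℕ → Set
      CollapseCases v = (v < B × collapse B hi v ≡ v) ⊎ (v ≡ lo × collapse B hi v ≡ B) ⊎ (v ≡ hi × collapse B hi v ≡ suc B)

      collapse-cases : ∀ {v} → SmallOr B lo hi v → CollapseCases v
      collapse-cases (inj₁ v<B)         = inj₁ (v<B , collapse-< v<B)
      collapse-cases (inj₂ (inj₁ refl)) = inj₂ (inj₁ (refl , collapse-other B≤lo (<⇒≢ lo<hi)))
      collapse-cases (inj₂ (inj₂ refl)) = inj₂ (inj₂ (refl , collapse-hi B≤hi))

    raise-collapse : ∀ {v} → SmallOr B lo hi v → raise B lo hi (collapse B hi v) ≡ v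
    raise-collapse v∈ with collapse-cases v∈
    ... | inj₁ (v<B , cv)          = trans (cong (raise B lo hi) cv) (raise-< v<B)
    ... | inj₂ (inj₁ (refl , cv)) = trans (cong (raise B lo hi) cv) (raise-B {B} {lo} {hi})
    ... | inj₂ (inj₂ (refl , cv)) = trans (cong (raise B lo hi) cv) (raise-1+B {B} {lo} {hi})

    collapse-increasing : StrictlyIncreasingOn (SmallOr B lo hi) (collapse B hi)
    collapse-increasing = section-increasing (raise-increasing B≤lo lo<hi) (λ _ → collapse-<2+B _) raise-collapse

    collapse-raise : ∀ {v} → v < 2 + B → collapse B hi (raise B lo hi v) ≡ v
    collapse-raise v<2+B with raise-cases {B} {lo} {hi} v<2+B
    ... | inj₁ (v<B , rv)          = trans (cong (collapse B hi) rv) (collapse-< v<B)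
    ... | inj₂ (inj₁ (refl , rv)) = trans (cong (collapse B hi) rv) (collapse-other B≤lo (<⇒≢ lo<hi))
    ... | inj₂ (inj₂ (refl , rv)) = trans (cong (collapse B hi) rv) (collapse-hi B≤hi)

∸-increasing : ∀ {B c} → c < B → StrictlyIncreasingOn (λ v → v ≡ c ⊎ B < v) (_∸ B)
∸-increasing c<B (inj₁ refl) (inj₁ refl) c<c = ⊥-elim (<-irrefl refl c<c)
∸-increasing {B} c<B {y = w} (inj₁ refl) (inj₂ B<w) _ = subst (_< w ∸ B) (sym (m≤n⇒m∸n≡0 (<⇒≤ c<B))) (m<n⇒0<n∸m B<w)
∸-increasing c<B (inj₂ B<v)  (inj₁ refl) v<c = ⊥-elim (<-asym (<-trans c<B B<v) v<c)
∸-increasing c<B (inj₂ B<v)  (inj₂ B<w)  v<w = ∸-monoˡ-< v<w (<⇒≤ B<v)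

shift-∸-inverse : ∀ {B c w} → c < B → w ≡ c ⊎ B < w → shift B c (w ∸ B) ≡ w
shift-∸-inverse c<B (inj₁ refl) = cong (shift _ _) (m≤n⇒m∸n≡0 (<⇒≤ c<B))
shift-∸-inverse {B} {c} {w} c<B (inj₂ B<w) with w ∸ B in w∸B≡
... | zero  = ⊥-elim (<⇒≢ (m<n⇒0<n∸m B<w) (sym w∸B≡))
... | suc v = trans (cong (_+ B) (sym w∸B≡)) (m∸n+n≡m (<⇒≤ B<w))

-- λ p → V (f (P p)) is the pattern of f at the increasing positions P, relabelled by the increasing V.
module Pattern {m : ℕ} {D : ℕ → Set} {P V f : ℕ → ℕ}
         (P-increasing : StrictlyIncreasingOn (_< m) P) (V-increasing : StrictlyIncreasingOn D V)
         (in-D : ∀ p → p < m → D (f (P p))) where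

  pattern-injective : ∀ {n} → (∀ p → p < m → P p < n) → InjectiveOn n f → InjectiveOn m (λ p → V (f (P p)))
  pattern-injective P< f-injective p q p<m q<m eq =
    increasing⇒injective P-increasing p<m q<m
      (f-injective _ _ (P< p p<m) (P< q q<m) (increasing⇒injective V-increasing (in-D p p<m) (in-D q q<m) eq))

  pattern-occurs321 : ∀ {p q r} → r < m → Occurs321 (λ p → V (f (P p))) p q r → Occurs321 f (P p) (P q) (P r)
  pattern-occurs321 {p} {q} {r} r<m ((p<q , q<r) , (Vq<Vp , Vr<Vq)) =
    (P-increasing p<m q<m p<q , P-increasing q<m r<m q<r) ,
    (increasing⇒reflects-< V-increasing (in-D q q<m) (in-D p p<m) Vq<Vp ,
     increasing⇒reflects-< V-increasing (in-D r r<m) (in-D q q<m) Vr<Vq)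
    where
    q<m = <-trans q<r r<m
    p<m = <-trans p<q q<m

minmax-cases : ∀ m n → (m ⊓ n ≡ m × m ⊔ n ≡ n) ⊎ (m ⊓ n ≡ n × m ⊔ n ≡ m)
minmax-cases m n with ≤-total m n
... | inj₁ m≤n = inj₁ (m≤n⇒m⊓n≡m m≤n , m≤n⇒m⊔n≡n m≤n)
... | inj₂ n≤m = inj₂ (m≥n⇒m⊓n≡n n≤m , m≥n⇒m⊔n≡m n≤m)

suffix-offset : ∀ {B p} → suc B < p → ∃ λ t → p ∸ B ≡ suc (suc t) × suc B + suc t ≡ p
suffix-offset {zero}  {suc (suc t)} _           = t , refl , refl
suffix-offset {zero}  {suc zero}    (s<s ())
suffix-offset {suc B} {suc p}       (s<s 1+B<p) = let t , p∸B≡ , p≡ = suffix-offset 1+B<p in t , p∸B≡ , cong suc p≡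

leftPosition : (j k p : ℕ) → ℕ
leftPosition j k p with p <? j
... | yes _ = p
... | no  _ = k

rightPosition : (i₁ i₂ j q : ℕ) → ℕ
rightPosition i₁ i₂ j zero          = i₁ ⊓ i₂
rightPosition i₁ i₂ j (suc zero)    = i₁ ⊔ i₂
rightPosition i₁ i₂ j (suc (suc t)) = j + suc t

-- ρ is the pattern of π on the positions in front of j followed by k, σ the pattern of π on
-- i₁, i₂ followed by the positions after j; σ's letter 0 is the image of π's letter at k.
splitLeft : (B : ℕ) (π : ℕ → ℕ) (i₁ i₂ j k : ℕ) → ℕ → ℕ
splitLeft B π i₁ i₂ j k p = collapse B (π (i₁ ⊔ i₂)) (π (leftPosition j k p))

splitRight : (B : ℕ) (π : ℕ → ℕ) (i₁ i₂ j : ℕ) → ℕ → ℕ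
splitRight B π i₁ i₂ j q = π (rightPosition i₁ i₂ j q) ∸ B

module _ {j k : ℕ} where

  leftPosition-< : ∀ {p} → p < j → leftPosition j k p ≡ p
  leftPosition-< {p} p<j with p <? j
  ... | yes _   = refl
  ... | no  p≮j = ⊥-elim (p≮j p<j)

  leftPosition-≮ : ∀ {p} → ¬ p < j → leftPosition j k p ≡ k
  leftPosition-≮ {p} p≮j with p <? j
  ... | yes p<j = ⊥-elim (p≮j p<j)
  ... | no  _   = refl

  leftPosition-increasing : j < k → StrictlyIncreasingOn (_< suc j) (leftPosition j k)
  leftPosition-increasing j<k {p} {q} _ q<1+j p<q with m<1+n⇒m<n∨m≡n q<1+j
  ... | inj₁ q<j  = subst₂ _<_ (sym (leftPosition-< (<-trans p<q q<j))) (sym (leftPosition-< q<j)) p<q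
  ... | inj₂ refl = subst₂ _<_ (sym (leftPosition-< p<q)) (sym (leftPosition-≮ (<-irrefl refl))) (<-trans p<q j<k)

record ExactlyTwo321 (B s : ℕ) (π : ℕ → ℕ) (i₁ i₂ j k : ℕ) : Set where
  field
    π-bounded   : ∀ p → π p < suc B + suc s
    π-injective : InjectiveOn (suc B + suc s) π
    k<N         : k < suc B + suc s
    occurs₁     : Occurs321 π i₁ j k
    occurs₂     : Occurs321 π i₂ j k
    i₁≢i₂       : i₁ ≢ i₂
    π-j         : π j ≡ B
    only        : ∀ p q r → r < suc B + suc s → Occurs321 π p q r → (p ≡ i₁ ⊎ p ≡ i₂) × q ≡ j × r ≡ k

module Splitting {B s : ℕ} {π : ℕ → ℕ} {i₁ i₂ j k : ℕ} (two : ExactlyTwo321 B s π i₁ i₂ j k) where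
  open ExactlyTwo321 two

  N x y c : ℕ
  N = suc B + suc s
  x = i₁ ⊓ i₂
  y = i₁ ⊔ i₂
  c = π k

  ρs σs : ℕ → ℕ
  ρs = splitLeft B π i₁ i₂ j k
  σs = splitRight B π i₁ i₂ j

  j<k : j < k
  j<k = proj₂ (proj₁ occurs₁)

  j<N : j < N
  j<N = <-trans j<k k<N

  c<B : c < B
  c<B = subst (c <_) π-j (proj₂ (proj₂ occurs₁))

  Inner : ℕ → Set
  Inner p = p ≡ i₁ ⊎ p ≡ i₂

  inner<j : ∀ {p} → Inner p → p < j
  inner<j (inj₁ refl) = proj₁ (proj₁ occurs₁)
  inner<j (inj₂ refl) = proj₁ (proj₁ occurs₂)

  inner-large : ∀ {p} → Inner p → B < π p
  inner-large (inj₁ refl) = subst (_< π i₁) π-j (proj₁ (proj₂ occurs₁))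
  inner-large (inj₂ refl) = subst (_< π i₂) π-j (proj₁ (proj₂ occurs₂))

  x-inner : Inner x
  x-inner with minmax-cases i₁ i₂
  ... | inj₁ (x≡i₁ , _) = inj₁ x≡i₁
  ... | inj₂ (x≡i₂ , _) = inj₂ x≡i₂

  y-inner : Inner y
  y-inner with minmax-cases i₁ i₂
  ... | inj₁ (_ , y≡i₂) = inj₂ y≡i₂
  ... | inj₂ (_ , y≡i₁) = inj₁ y≡i₁

  inner⇒x∨y : ∀ {p} → Inner p → p ≡ x ⊎ p ≡ y
  inner⇒x∨y p∈ with minmax-cases i₁ i₂ | p∈
  ... | inj₁ (x≡i₁ , _) | inj₁ p≡i₁ = inj₁ (trans p≡i₁ (sym x≡i₁))
  ... | inj₁ (_ , y≡i₂) | inj₂ p≡i₂ = inj₂ (trans p≡i₂ (sym y≡i₂))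
  ... | inj₂ (_ , y≡i₁) | inj₁ p≡i₁ = inj₂ (trans p≡i₁ (sym y≡i₁))
  ... | inj₂ (x≡i₂ , _) | inj₂ p≡i₂ = inj₁ (trans p≡i₂ (sym x≡i₂))

  x<y : x < y
  x<y = ≤∧≢⇒< (m⊓n≤m⊔n i₁ i₂) x≢y
    where
    x≢y : x ≢ y
    x≢y x≡y with minmax-cases i₁ i₂
    ... | inj₁ (x≡i₁ , y≡i₂) = i₁≢i₂ (trans (sym x≡i₁) (trans x≡y y≡i₂))
    ... | inj₂ (x≡i₂ , y≡i₁) = i₁≢i₂ (trans (sym y≡i₁) (trans (sym x≡y) x≡i₂))

  -- Otherwise (x, y, j) would be a third occurrence.
  πx<πy : π x < π y
  πx<πy with <-cmp (π x) (π y)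
  ... | tri< lt _ _ = lt
  ... | tri≈ _ eq _ = ⊥-elim (<⇒≢ x<y (π-injective _ _ (<-trans (inner<j x-inner) j<N) (<-trans (inner<j y-inner) j<N) eq))
  ... | tri> _ _ gt = ⊥-elim (<⇒≢ (inner<j y-inner) (proj₁ (proj₂ (only x y j j<N
                        ((x<y , inner<j y-inner) , (gt , subst (_< π y) (sym π-j) (inner-large y-inner)))))))

  B<πx : B < π x
  B<πx = inner-large x-inner

  prefix-letters : ∀ {p} → p < j → π p < B ⊎ p ≡ x ⊎ p ≡ y
  prefix-letters {p} p<j with <-cmp (π p) B
  ... | tri< πp<B _ _ = inj₁ πp<B
  ... | tri≈ _ πp≡B _ = ⊥-elim (<⇒≢ p<j (π-injective _ _ (<-trans p<j j<N) j<N (trans πp≡B (sym π-j))))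
  ... | tri> _ _ B<πp = inj₂ (inner⇒x∨y (proj₁ (only p j k k<N
                          ((p<j , j<k) , (subst (_< π p) (sym π-j) B<πp , proj₂ (proj₂ occurs₁))))))

  suffix-letters : ∀ {p} → j < p → p < N → π p ≡ c ⊎ B < π p
  suffix-letters {p} j<p p<N with <-cmp (π p) B
  ... | tri< πp<B _ _ = inj₁ (cong π (proj₂ (proj₂ (only x j p p<N
                          ((inner<j x-inner , j<p) , (subst (_< π x) (sym π-j) B<πx , subst (π p <_) (sym π-j) πp<B))))))
  ... | tri≈ _ πp≡B _ = ⊥-elim (>⇒≢ j<p (π-injective _ _ p<N j<N (trans πp≡B (sym π-j))))
  ... | tri> _ _ B<πp = inj₂ B<πp

  left-letters : ∀ p → p < suc j → SmallOr B (π x) (π y) (π (leftPosition j k p))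
  left-letters p p<1+j with m<1+n⇒m<n∨m≡n p<1+j
  ... | inj₂ refl = subst (SmallOr B (π x) (π y)) (cong π (sym (leftPosition-≮ {j} {k} (<-irrefl refl)))) (inj₁ c<B)
  ... | inj₁ p<j  = subst (SmallOr B (π x) (π y)) (cong π (sym (leftPosition-< {j} {k} p<j))) (letters (prefix-letters p<j))
    where
    letters : π p < B ⊎ p ≡ x ⊎ p ≡ y → SmallOr B (π x) (π y) (π p)
    letters (inj₁ πp<B)       = inj₁ πp<B
    letters (inj₂ (inj₁ p≡x)) = inj₂ (inj₁ (cong π p≡x))
    letters (inj₂ (inj₂ p≡y)) = inj₂ (inj₂ (cong π p≡y))

  leftPosition-<N : ∀ p → p < suc j → leftPosition j k p < N
  leftPosition-<N p p<1+j with m<1+n⇒m<n∨m≡n p<1+j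
  ... | inj₁ p<j  = subst (_< N) (sym (leftPosition-< {j} {k} p<j)) (<-trans p<j j<N)
  ... | inj₂ refl = subst (_< N) (sym (leftPosition-≮ {j} {k} (<-irrefl refl))) k<N

  private
    module Left = Pattern {P = leftPosition j k} {V = collapse B (π y)} {f = π}
                    (leftPosition-increasing j<k) (collapse-increasing (<⇒≤ B<πx) πx<πy) left-letters

  ρs-injective′ : InjectiveOn (suc j) ρs
  ρs-injective′ = Left.pattern-injective leftPosition-<N π-injective

  ρs-avoids′ : Avoids321Below (suc j) ρs
  ρs-avoids′ p q r r<1+j occ
    with only _ _ _ (leftPosition-<N r r<1+j) (Left.pattern-occurs321 r<1+j occ)
  ... | _ , lq≡j , _ = <⇒≢ q<j (trans (sym (leftPosition-< {j} {k} q<j)) lq≡j)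
    where q<j = <-≤-trans (proj₂ (proj₁ occ)) (s≤s⁻¹ r<1+j)

  j<j+1+t : ∀ t → j < j + suc t
  j<j+1+t t = m<m+n j z<s

  rightPosition-increasing : ∀ {m} → StrictlyIncreasingOn (_< m) (rightPosition i₁ i₂ j)
  rightPosition-increasing {x = zero}        {zero}         _ _ ()
  rightPosition-increasing {x = zero}        {suc zero}     _ _ _ = x<y
  rightPosition-increasing {x = zero}        {suc (suc t)}  _ _ _ = <-trans (inner<j x-inner) (j<j+1+t t)
  rightPosition-increasing {x = suc _}       {zero}         _ _ ()
  rightPosition-increasing {x = suc zero}    {suc zero}     _ _ (s<s ())
  rightPosition-increasing {x = suc zero}    {suc (suc t)}  _ _ _ = <-trans (inner<j y-inner) (j<j+1+t t)
  rightPosition-increasing {x = suc (suc _)} {suc zero}     _ _ (s<s ())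
  rightPosition-increasing {x = suc (suc _)} {suc (suc _)}  _ _ (s<s (s<s t<t′)) = +-monoʳ-< j (s<s t<t′)

  rightPosition-≢j : ∀ q → rightPosition i₁ i₂ j q ≢ j
  rightPosition-≢j zero          = <⇒≢ (inner<j x-inner)
  rightPosition-≢j (suc zero)    = <⇒≢ (inner<j y-inner)
  rightPosition-≢j (suc (suc t)) = >⇒≢ (j<j+1+t t)

  rightPosition-<N : ∀ q → q < 2 + (N ∸ suc j) → rightPosition i₁ i₂ j q < N
  rightPosition-<N zero          _               = <-trans (inner<j x-inner) j<N
  rightPosition-<N (suc zero)    _               = <-trans (inner<j y-inner) j<N
  rightPosition-<N (suc (suc t)) (s<s (s<s t<)) = begin-strict
    j + suc t          ≡⟨ +-suc j t ⟩
    suc j + t          <⟨ +-monoʳ-< (suc j) t< ⟩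
    suc j + (N ∸ suc j) ≡⟨ m+[n∸m]≡n j<N ⟩
    N                  ∎
    where open ≤-Reasoning

  right-letters : ∀ q → q < 2 + (N ∸ suc j) → π (rightPosition i₁ i₂ j q) ≡ c ⊎ B < π (rightPosition i₁ i₂ j q)
  right-letters zero          _   = inj₂ B<πx
  right-letters (suc zero)    _   = inj₂ (inner-large y-inner)
  right-letters (suc (suc t)) q<  = suffix-letters (j<j+1+t t) (rightPosition-<N (suc (suc t)) q<)

  private
    module Right = Pattern {P = rightPosition i₁ i₂ j} {V = _∸ B} {f = π}
                     rightPosition-increasing (∸-increasing c<B) right-letters

  σs-injective′ : InjectiveOn (2 + (N ∸ suc j)) σs
  σs-injective′ = Right.pattern-injective rightPosition-<N π-injective

  σs-avoids′ : Avoids321Below (2 + (N ∸ suc j)) σs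
  σs-avoids′ p q r r< occ
    with only _ _ _ (rightPosition-<N r r<) (Right.pattern-occurs321 r< occ)
  ... | _ , rq≡j , _ = rightPosition-≢j q rq≡j

  ρs-< : ∀ p → ρs p < 2 + B
  ρs-< p = collapse-<2+B _

  σs-< : ∀ q → σs q < 2 + s
  σs-< q = suffix-index< B s (π-bounded _)

  -- Counting: ρ has j + 1 distinct letters below B + 2, σ has N - j + 1 distinct letters below s + 2.
  j≡1+B : j ≡ suc B
  j≡1+B = ≤-antisym (s≤s⁻¹ (injectiveOn⇒≤ ρs (λ p _ → ρs-< p) ρs-injective′)) (≮⇒≥ j≮1+B)
    where
    j≮1+B : ¬ j < suc B
    j≮1+B j<1+B = 1+n≰n (≤-trans (subst (_≤ N ∸ suc j) (m+n∸m≡n (suc B) (suc s)) (∸-monoʳ-≤ N j<1+B))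
                                  (s≤s⁻¹ (s≤s⁻¹ (injectiveOn⇒≤ σs (λ q _ → σs-< q) σs-injective′))))

  N∸1+j : N ∸ suc j ≡ s
  N∸1+j = begin
    N ∸ suc j                 ≡⟨ cong (λ j → N ∸ suc j) j≡1+B ⟩
    suc B + suc s ∸ suc (suc B) ≡⟨ cong (_∸ suc (suc B)) (+-suc (suc B) s) ⟩
    suc (suc B) + s ∸ suc (suc B) ≡⟨ m+n∸m≡n (suc (suc B)) s ⟩
    s                         ∎
    where open ≡-Reasoning

  ρs-1+B : ρs (suc B) ≡ c
  ρs-1+B = trans (cong (λ p → collapse B (π y) (π p)) (leftPosition-≮ {j} {k} (<-irrefl (sym j≡1+B)))) (collapse-< c<B)

  zero-pos : ℕ
  zero-pos = 2 + (k ∸ suc j)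

  rightPosition-zero-pos : rightPosition i₁ i₂ j zero-pos ≡ k
  rightPosition-zero-pos = trans (+-suc j (k ∸ suc j)) (m+[n∸m]≡n j<k)

  rhoConditions : RhoConditions B ρs
  rhoConditions = record
    { ρ-injective = subst (λ j → InjectiveOn (suc j) ρs) j≡1+B ρs-injective′
    ; ρ-bounded   = ρs-<
    ; ρ-avoids    = subst (λ j → Avoids321Below (suc j) ρs) j≡1+B ρs-avoids′
    ; ρ-last<     = subst (_< B) (sym ρs-1+B) c<B
    }

  sigmaConditions : SigmaConditions s σs
  sigmaConditions = record
    { σ-injective = subst (λ m → InjectiveOn (2 + m) σs) N∸1+j σs-injective′
    ; σ-bounded   = σs-<
    ; σ-avoids    = subst (λ m → Avoids321Below (2 + m) σs) N∸1+j σs-avoids′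
    ; zero-pos    = zero-pos
    ; 2≤zero-pos  = s≤s (s≤s z≤n)
    ; zero-pos<   = s<s (s<s (subst (k ∸ suc j <_) N∸1+j (∸-monoˡ-< k<N j<k)))
    ; σ-zero-pos  = trans (cong (λ p → π p ∸ B) rightPosition-zero-pos) (m≤n⇒m∸n≡0 (<⇒≤ c<B))
    }

  glue-split : AgreeBelow N (glue B ρs σs) π
  glue-split p p<N with segment B p
  ... | prefix p<1+B = begin
    glue B ρs σs p                                         ≡⟨ glue-prefix p<1+B ⟩
    raise B (σs 0 + B) (σs 1 + B) (ρs p)                   ≡⟨ cong₂ (λ lo hi → raise B lo hi (ρs p)) (m∸n+n≡m (<⇒≤ B<πx)) (m∸n+n≡m (<⇒≤ B<πy)) ⟩
    raise B (π x) (π y) (collapse B (π y) (π (leftPosition j k p))) ≡⟨ raise-collapse (<⇒≤ B<πx) πx<πy (left-letters p (m<n⇒m<1+n p<j)) ⟩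
    π (leftPosition j k p)                                 ≡⟨ cong π (leftPosition-< {j} {k} p<j) ⟩
    π p                                                    ∎
    where
    open ≡-Reasoning
    p<j = subst (p <_) (sym j≡1+B) p<1+B
    B<πy = <-trans B<πx πx<πy
  ... | middle refl = trans glue-middle (trans (sym π-j) (cong π j≡1+B))
  ... | suffix 1+B<p with suffix-offset 1+B<p
  ...   | t , p∸B≡ , p≡ = begin
    glue B ρs σs p                           ≡⟨ glue-suffix 1+B<p ⟩
    shift B (ρs (suc B)) (σs (p ∸ B))        ≡⟨ cong₂ (shift B) ρs-1+B (cong σs p∸B≡) ⟩
    shift B c (π (j + suc t) ∸ B)            ≡⟨ cong (λ q → shift B c (π q ∸ B)) j+1+t≡p ⟩
    shift B c (π p ∸ B)                      ≡⟨ shift-∸-inverse c<B (suffix-letters (subst (_< p) (sym j≡1+B) 1+B<p) p<N) ⟩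
    π p                                      ∎
    where
    open ≡-Reasoning
    j+1+t≡p = trans (cong (_+ suc t) j≡1+B) p≡

module SplittingGlued {B s : ℕ} {ρ σ : ℕ → ℕ} (ρ-ok : RhoConditions B ρ) (σ-ok : SigmaConditions s σ) where
  open RhoConditions ρ-ok
  open SigmaConditions σ-ok
  open Gluing ρ-ok σ-ok

  π-pB : π pB ≡ σ 0 + B
  π-pB = trans (π-prefix pB<1+B) (trans (cong lift ρ-pB) (raise-B {B} {σ 0 + B} {σ 1 + B}))

  π-pB1 : π pB1 ≡ σ 1 + B
  π-pB1 = trans (π-prefix pB1<1+B) (trans (cong lift ρ-pB1) (raise-1+B {B} {σ 0 + B} {σ 1 + B}))

  Tops : ℕ → ℕ → Set
  Tops i₁ i₂ = (i₁ ≡ pB × i₂ ≡ pB1) ⊎ (i₁ ≡ pB1 × i₂ ≡ pB)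

  tops-min : ∀ {i₁ i₂} → Tops i₁ i₂ → i₁ ⊓ i₂ ≡ pB
  tops-min (inj₁ (refl , refl)) = m≤n⇒m⊓n≡m (<⇒≤ pB<pB1)
  tops-min (inj₂ (refl , refl)) = m≥n⇒m⊓n≡n (<⇒≤ pB<pB1)

  tops-max : ∀ {i₁ i₂} → Tops i₁ i₂ → i₁ ⊔ i₂ ≡ pB1
  tops-max (inj₁ (refl , refl)) = m≤n⇒m⊔n≡n (<⇒≤ pB<pB1)
  tops-max (inj₂ (refl , refl)) = m≥n⇒m⊔n≡m (<⇒≤ pB<pB1)

  module _ {π′ : ℕ → ℕ} (π′≗π : AgreeBelow N π′ π) {i₁ i₂ : ℕ} (tops : Tops i₁ i₂) where

    private
      agree-prefix : ∀ {p} → p < suc B → π′ p ≡ π p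
      agree-prefix p<1+B = π′≗π _ (<-≤-trans p<1+B (m≤m+n (suc B) (suc s)))

      π′-max : π′ (i₁ ⊔ i₂) ≡ σ 1 + B
      π′-max = trans (cong π′ (tops-max tops)) (trans (agree-prefix pB1<1+B) π-pB1)

    splitLeft-glue : AgreeBelow (2 + B) (splitLeft B π′ i₁ i₂ (suc B) k) ρ
    splitLeft-glue p p<2+B with m<1+n⇒m<n∨m≡n p<2+B
    ... | inj₁ p<1+B = begin
      collapse B (π′ (i₁ ⊔ i₂)) (π′ (leftPosition (suc B) k p)) ≡⟨ cong₂ (collapse B) π′-max (cong π′ (leftPosition-< {suc B} {k} p<1+B)) ⟩
      collapse B (σ 1 + B) (π′ p)                               ≡⟨ cong (collapse B (σ 1 + B)) (trans (agree-prefix p<1+B) (π-prefix p<1+B)) ⟩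
      collapse B (σ 1 + B) (lift (ρ p))                         ≡⟨ collapse-raise (m≤n+m B (σ 0)) (+-monoˡ-< B σ₀<σ₁) (ρ-bounded p) ⟩
      ρ p                                                       ∎
      where open ≡-Reasoning
    ... | inj₂ refl = begin
      collapse B (π′ (i₁ ⊔ i₂)) (π′ (leftPosition (suc B) k (suc B))) ≡⟨ cong₂ (collapse B) π′-max (cong π′ (leftPosition-≮ {suc B} {k} (<-irrefl refl))) ⟩
      collapse B (σ 1 + B) (π′ k)                                    ≡⟨ cong (collapse B (σ 1 + B)) (trans (π′≗π k k<N) π-k) ⟩
      collapse B (σ 1 + B) c                                         ≡⟨ collapse-< ρ-last< ⟩
      c                                                              ∎
      where open ≡-Reasoning

    splitRight-glue : AgreeBelow (2 + s) (splitRight B π′ i₁ i₂ (suc B)) σ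
    splitRight-glue zero _ = begin
      π′ (i₁ ⊓ i₂) ∸ B ≡⟨ cong (λ p → π′ p ∸ B) (tops-min tops) ⟩
      π′ pB ∸ B        ≡⟨ cong (_∸ B) (trans (agree-prefix pB<1+B) π-pB) ⟩
      σ 0 + B ∸ B      ≡⟨ m+n∸n≡m (σ 0) B ⟩
      σ 0              ∎
      where open ≡-Reasoning
    splitRight-glue (suc zero) _ = begin
      π′ (i₁ ⊔ i₂) ∸ B ≡⟨ cong (_∸ B) π′-max ⟩
      σ 1 + B ∸ B      ≡⟨ m+n∸n≡m (σ 1) B ⟩
      σ 1              ∎
      where open ≡-Reasoning
    splitRight-glue (suc (suc t)) q<2+s = begin
      π′ p ∸ B                 ≡⟨ cong (_∸ B) (trans (π′≗π p p<N) (π-suffix 1+B<p)) ⟩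
      shiftᶜ (σ (p ∸ B)) ∸ B   ≡⟨ shift-∸ ρ-last< (σ (p ∸ B)) ⟩
      σ (p ∸ B)                ≡⟨ cong σ p∸B≡ ⟩
      σ (suc (suc t))          ∎
      where
      open ≡-Reasoning
      p = suc B + suc t
      p∸B≡ : p ∸ B ≡ suc (suc t)
      p∸B≡ = trans (cong (_∸ B) (sym (+-suc B (suc t)))) (m+n∸m≡n B (suc (suc t)))
      1+B<p : suc B < p
      1+B<p = m<m+n (suc B) z<s
      p<N : p < N
      p<N = +-monoʳ-< (suc B) (s<s⁻¹ q<2+s)

-- The bijection

-- The predicates refined by TwoOcc, RhoSet and SigmaSet.
IsTwoOcc : (n b : ℕ) → Word n → Set
IsTwoOcc n b π = IsPermutation π ×
  (∃[ i₁ ] ∃[ j₁ ] ∃[ k₁ ] ∃[ i₂ ] ∃[ j₂ ] ∃[ k₂ ]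
     (occurrences321 π ≡ (i₁ , j₁ , k₁) ∷ (i₂ , j₂ , k₂) ∷ [])
     × letter (lookup π j₁) ≡ b × letter (lookup π j₂) ≡ b
     × lookup π k₁ ≡ lookup π k₂)

IsRho : (b : ℕ) → Word (suc b) → Set
IsRho b ρ = IsPermutation ρ × Avoids321 ρ × letter (last ρ) ≤ b ∸ 1

IsSigma : (k : ℕ) → Word k → Set
IsSigma k σ = IsPermutation σ × Avoids321 σ × (∃[ p ] letter (lookup σ p) ≡ 1 × 3 ≤ suc (toℕ p))

SigmaWords : ℕ → Set
SigmaWords k = Refinement (Word k) (IsSigma k)

module _ {B : ℕ} {ρ : Word (2 + B)} where

  isRho⇒rhoConditions : IsRho (suc B) ρ → RhoConditions B (entry ρ)
  isRho⇒rhoConditions (perm , avoid , last≤) = record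
    { ρ-injective = isPermutation⇒injectiveOn ρ perm
    ; ρ-bounded   = entry-< ρ
    ; ρ-avoids    = avoids321⇒avoids321Below ρ avoid
    ; ρ-last<     = subst (_< B) (entry-last ρ) last≤
    }

  rhoConditions⇒isRho : ∀ {f} → AgreeBelow (2 + B) f (entry ρ) → RhoConditions B f → IsRho (suc B) ρ
  rhoConditions⇒isRho f≗ρ ρ-ok =
    injectiveOn⇒isPermutation ρ (injectiveOn-agree f≗ρ ρ-injective) ,
    avoids321Below⇒avoids321 ρ (avoids321-agree f≗ρ ρ-avoids) ,
    subst (_< B) (trans (f≗ρ (suc B) (n<1+n (suc B))) (sym (entry-last ρ))) ρ-last<
    where open RhoConditions ρ-ok

module _ {s : ℕ} {σ : Word (2 + s)} where

  isSigma⇒sigmaConditions : IsSigma (2 + s) σ → SigmaConditions s (entry σ)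
  isSigma⇒sigmaConditions (perm , avoid , p , σp≡1 , 3≤1+p) = record
    { σ-injective = isPermutation⇒injectiveOn σ perm
    ; σ-bounded   = entry-< σ
    ; σ-avoids    = avoids321⇒avoids321Below σ avoid
    ; zero-pos    = toℕ p
    ; 2≤zero-pos  = s≤s⁻¹ 3≤1+p
    ; zero-pos<   = toℕ<n p
    ; σ-zero-pos  = trans (entry-lookup σ p) (suc-injective σp≡1)
    }

  sigmaConditions⇒isSigma : ∀ {f} → AgreeBelow (2 + s) f (entry σ) → SigmaConditions s f → IsSigma (2 + s) σ
  sigmaConditions⇒isSigma f≗σ σ-ok =
    injectiveOn⇒isPermutation σ (injectiveOn-agree f≗σ σ-injective) ,
    avoids321Below⇒avoids321 σ (avoids321-agree f≗σ σ-avoids) ,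
    fromℕ< zero-pos< ,
    cong suc (trans (sym (entry-fromℕ< σ zero-pos<)) (trans (sym (f≗σ zero-pos zero-pos<)) σ-zero-pos)) ,
    subst (λ z → 3 ≤ suc z) (sym (toℕ-fromℕ< zero-pos<)) (s≤s 2≤zero-pos)
    where open SigmaConditions σ-ok

module Words (B s : ℕ) where

  N : ℕ
  N = suc B + suc s

  glueWord : Word (2 + B) → Word (2 + s) → Word N
  glueWord ρ σ = tabulateℕ N (glue B (entry ρ) (entry σ))

  splitPair : Word N → Triple N → Triple N → Word (2 + B) × Word (2 + s)
  splitPair π (i₁ , j , k) (i₂ , _ , _) =
    tabulateℕ (2 + B) (splitLeft B (entry π) (toℕ i₁) (toℕ i₂) (toℕ j) (toℕ k)) ,
    tabulateℕ (2 + s) (splitRight B (entry π) (toℕ i₁) (toℕ i₂) (toℕ j))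

  -- The junk clause is never reached on words with exactly two occurrences of 321.
  splitWord : Word N → Word (2 + B) × Word (2 + s)
  splitWord π with occurrences321 π
  ... | t₁ ∷ t₂ ∷ [] = splitPair π t₁ t₂
  ... | _            = tabulateℕ (2 + B) (λ _ → 0) , tabulateℕ (2 + s) (λ _ → 0)

  splitWord-≡ : ∀ {π t₁ t₂} → occurrences321 π ≡ t₁ ∷ t₂ ∷ [] → splitWord π ≡ splitPair π t₁ t₂
  splitWord-≡ occs rewrite occs = refl

  fromℕ<-≡ : ∀ {p} (p<N : p < N) {i : Fin N} → fromℕ< p<N ≡ i → p ≡ toℕ i
  fromℕ<-≡ p<N refl = sym (toℕ-fromℕ< p<N)

  isTwoOcc⇒exactlyTwo321 : ∀ {π i₁ j₁ k₁ i₂ j₂ k₂} → IsPermutation π →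
    occurrences321 π ≡ (i₁ , j₁ , k₁) ∷ (i₂ , j₂ , k₂) ∷ [] →
    letter (lookup π j₁) ≡ suc B → letter (lookup π j₂) ≡ suc B → lookup π k₁ ≡ lookup π k₂ →
    ExactlyTwo321 B s (entry π) (toℕ i₁) (toℕ i₂) (toℕ j₁) (toℕ k₁)
  isTwoOcc⇒exactlyTwo321 {π} {i₁} {j₁} {k₁} {i₂} {j₂} {k₂} perm occs l₁ l₂ πk₁≡πk₂ = record
    { π-bounded   = entry-< π
    ; π-injective = isPermutation⇒injectiveOn π perm
    ; k<N         = toℕ<n k₁
    ; occurs₁     = occ321⇒occurs321 π (∈-occurrences321⁻ π (subst (_ ∈_) (sym occs) (here refl)))
    ; occurs₂     = occ321⇒occurs321 π (subst₂ (Occ321 π i₂) (sym j₁≡j₂) (sym k₁≡k₂)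
                      (∈-occurrences321⁻ π (subst (_ ∈_) (sym occs) (there (here refl)))))
    ; i₁≢i₂       = i₁≢i₂
    ; π-j         = trans (entry-lookup π j₁) (suc-injective l₁)
    ; only        = only
    }
    where
    j₁≡j₂ : j₁ ≡ j₂
    j₁≡j₂ = perm j₁ j₂ (toℕ-injective (suc-injective (trans l₁ (sym l₂))))

    k₁≡k₂ : k₁ ≡ k₂
    k₁≡k₂ = perm k₁ k₂ πk₁≡πk₂

    i₁≢i₂ : toℕ i₁ ≢ toℕ i₂
    i₁≢i₂ i₁≡i₂ with subst Unique occs (occurrences321-unique π)
    ... | (t₁≢t₂ ∷ _) ∷ _ = t₁≢t₂ (cong₂ _,_ (toℕ-injective i₁≡i₂) (cong₂ _,_ j₁≡j₂ k₁≡k₂))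

    only : ∀ p q r → r < N → Occurs321 (entry π) p q r → (p ≡ toℕ i₁ ⊎ p ≡ toℕ i₂) × q ≡ toℕ j₁ × r ≡ toℕ k₁
    only p q r r<N occ@((p<q , q<r) , _) =
      classify (subst (t ∈_) occs (∈-occurrences321⁺ π (occurs321⇒occ321ᶠ π p<N q<N r<N occ)))
      where
      q<N = <-trans q<r r<N
      p<N = <-trans p<q q<N
      t = (fromℕ< p<N , fromℕ< q<N , fromℕ< r<N)
      classify : t ∈ (i₁ , j₁ , k₁) ∷ (i₂ , j₂ , k₂) ∷ [] → (p ≡ toℕ i₁ ⊎ p ≡ toℕ i₂) × q ≡ toℕ j₁ × r ≡ toℕ k₁
      classify (here eq)         = inj₁ (fromℕ<-≡ p<N (cong proj₁ eq)) ,
                                   fromℕ<-≡ q<N (cong (proj₁ ∘ proj₂) eq) , fromℕ<-≡ r<N (cong (proj₂ ∘ proj₂) eq)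
      classify (there (here eq)) = inj₂ (fromℕ<-≡ p<N (cong proj₁ eq)) ,
                                   trans (fromℕ<-≡ q<N (cong (proj₁ ∘ proj₂) eq)) (cong toℕ (sym j₁≡j₂)) ,
                                   trans (fromℕ<-≡ r<N (cong (proj₂ ∘ proj₂) eq)) (cong toℕ (sym k₁≡k₂))

  SplitsInto : Word N → Word (2 + B) × Word (2 + s) → Set
  SplitsInto π (ρ , σ) = IsRho (suc B) ρ × IsSigma (2 + s) σ × glueWord ρ σ ≡ π

  splitWord-correct : ∀ {π} → IsTwoOcc N (suc B) π → SplitsInto π (splitWord π)
  splitWord-correct {π} (perm , i₁ , j₁ , k₁ , i₂ , j₂ , k₂ , occs , l₁ , l₂ , πk₁≡πk₂) =
    subst (SplitsInto π) (sym (splitWord-≡ occs))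
      (rhoConditions⇒isRho {ρ = ρv} ρs≗ρv rhoConditions ,
       sigmaConditions⇒isSigma {σ = σv} σs≗σv sigmaConditions ,
       entry-injective _ _ glued)
    where
    open Splitting (isTwoOcc⇒exactlyTwo321 {π} perm occs l₁ l₂ πk₁≡πk₂)
      using (ρs; σs; ρs-<; σs-<; rhoConditions; sigmaConditions; glue-split)

    ρv : Word (2 + B)
    ρv = tabulateℕ (2 + B) ρs

    σv : Word (2 + s)
    σv = tabulateℕ (2 + s) σs

    ρs≗ρv : AgreeBelow (2 + B) ρs (entry ρv)
    ρs≗ρv p p<2+B = sym (entry-tabulateℕ ρs p<2+B (ρs-< p))

    σs≗σv : AgreeBelow (2 + s) σs (entry σv)
    σs≗σv q q<2+s = sym (entry-tabulateℕ σs q<2+s (σs-< q))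

    glued : AgreeBelow N (entry (glueWord ρv σv)) (entry π)
    glued p p<N = trans (entry-tabulateℕ (glue B (entry ρv) (entry σv)) p<N (subst (_< N) (sym glue≡π) (entry-< π p))) glue≡π
      where
      glue≡π : glue B (entry ρv) (entry σv) p ≡ entry π p
      glue≡π = trans (glue-cong (λ p p< → sym (ρs≗ρv p p<)) (λ q q< → sym (σs≗σv q q<)) p p<N) (glue-split p p<N)

  glueWord-correct : ∀ {ρ σ} → IsRho (suc B) ρ → IsSigma (2 + s) σ →
                     IsTwoOcc N (suc B) (glueWord ρ σ) × splitWord (glueWord ρ σ) ≡ (ρ , σ)
  glueWord-correct {ρ} {σ} ρ-word σ-word = by-occurrences occurrences
    where
    ρ-ok = isRho⇒rhoConditions {ρ = ρ} ρ-word
    σ-ok = isSigma⇒sigmaConditions {σ = σ} σ-word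
    open Gluing ρ-ok σ-ok using (π; glue-<; glue-injective; π-middle; pB; pB1; pB<1+B; pB1<1+B; ρ-pB; ρ-pB1; pB<pB1;
                                 k; 1+B<k; k<N; occurs321-glue⁺; occurs321-glue⁻)
    open SplittingGlued ρ-ok σ-ok using (Tops; splitLeft-glue; splitRight-glue)

    πv : Word N
    πv = glueWord ρ σ

    πv≗π : AgreeBelow N (entry πv) π
    πv≗π p p<N = entry-tabulateℕ π p<N (glue-< p)

    π≗πv : AgreeBelow N π (entry πv)
    π≗πv p p<N = sym (πv≗π p p<N)

    1+B<N : suc B < N
    1+B<N = <-trans 1+B<k k<N

    prefix<N : ∀ {p} → p < suc B → p < N
    prefix<N p<1+B = <-≤-trans p<1+B (m≤m+n (suc B) (suc s))

    occurrence-at : ∀ {p} → p < suc B → Triple N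
    occurrence-at p<1+B = fromℕ< (prefix<N p<1+B) , fromℕ< 1+B<N , fromℕ< k<N

    t₁ t₂ : Triple N
    t₁ = occurrence-at pB<1+B
    t₂ = occurrence-at pB1<1+B

    occurrence-at-∈ : ∀ {p} (p<1+B : p < suc B) → B ≤ entry ρ p → occurrence-at p<1+B ∈ occurrences321 πv
    occurrence-at-∈ p<1+B B≤ρp = ∈-occurrences321⁺ πv (occurs321⇒occ321ᶠ πv (prefix<N p<1+B) 1+B<N k<N
      (occurs321-agree π≗πv k<N (occurs321-glue⁺ p<1+B B≤ρp)))

    ∈⇒t₁∨t₂ : ∀ {t} → t ∈ occurrences321 πv → t ≡ t₁ ⊎ t ≡ t₂
    ∈⇒t₁∨t₂ {i , j , k′} t∈ = classify (occurs321-glue⁻ (toℕ<n k′)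
      (occurs321-agree πv≗π (toℕ<n k′) (occ321⇒occurs321 πv (∈-occurrences321⁻ πv t∈))))
      where
      fin : ∀ {a} {x : Fin N} (a<N : a < N) → toℕ x ≡ a → x ≡ fromℕ< a<N
      fin a<N e = toℕ-injective (trans e (sym (toℕ-fromℕ< a<N)))
      classify : (toℕ i ≡ pB ⊎ toℕ i ≡ pB1) × toℕ j ≡ suc B × toℕ k′ ≡ k → (i , j , k′) ≡ t₁ ⊎ (i , j , k′) ≡ t₂
      classify (i≡ , j≡ , k≡) = Data.Sum.map (same pB<1+B) (same pB1<1+B) i≡
        where
        same : ∀ {p} (p<1+B : p < suc B) → toℕ i ≡ p → (i , j , k′) ≡ occurrence-at p<1+B
        same p<1+B i≡p = cong₂ _,_ (fin (prefix<N p<1+B) i≡p) (cong₂ _,_ (fin 1+B<N j≡) (fin k<N k≡))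

    t₁≢t₂ : t₁ ≢ t₂
    t₁≢t₂ t₁≡t₂ = <⇒≢ pB<pB1 (trans (sym (toℕ-fromℕ< _)) (trans (cong (toℕ ∘ proj₁) t₁≡t₂) (toℕ-fromℕ< _)))

    occurrences : occurrences321 πv ≡ t₁ ∷ t₂ ∷ [] ⊎ occurrences321 πv ≡ t₂ ∷ t₁ ∷ []
    occurrences = unique-pair (occurrences321-unique πv) t₁≢t₂ ∈⇒t₁∨t₂
      (occurrence-at-∈ pB<1+B (≤-reflexive (sym ρ-pB))) (occurrence-at-∈ pB1<1+B (subst (B ≤_) (sym ρ-pB1) (n≤1+n B)))

    letter-middle : letter (lookup πv (fromℕ< 1+B<N)) ≡ suc B
    letter-middle = cong suc (trans (sym (entry-fromℕ< πv 1+B<N)) (trans (πv≗π _ 1+B<N) π-middle))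

    permutation : IsPermutation πv
    permutation = injectiveOn⇒isPermutation πv (injectiveOn-agree π≗πv glue-injective)

    splitPair-glue : ∀ {i₁ i₂} → Tops (toℕ i₁) (toℕ i₂) →
                     splitPair πv (i₁ , fromℕ< 1+B<N , fromℕ< k<N) (i₂ , fromℕ< 1+B<N , fromℕ< k<N) ≡ (ρ , σ)
    splitPair-glue {i₁} {i₂} tops = cong₂ _,_
      (entry-injective _ _ λ p p<2+B → begin
        entry (tabulateℕ (2 + B) (splitLeft B (entry πv) (toℕ i₁) (toℕ i₂) (toℕ f₁₊B) (toℕ fₖ))) p
          ≡⟨ entry-tabulateℕ (splitLeft B (entry πv) (toℕ i₁) (toℕ i₂) (toℕ f₁₊B) (toℕ fₖ)) p<2+B (collapse-<2+B _) ⟩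
        splitLeft B (entry πv) (toℕ i₁) (toℕ i₂) (toℕ f₁₊B) (toℕ fₖ) p
          ≡⟨ cong₂ (λ j k → splitLeft B (entry πv) (toℕ i₁) (toℕ i₂) j k p) (toℕ-fromℕ< 1+B<N) (toℕ-fromℕ< k<N) ⟩
        splitLeft B (entry πv) (toℕ i₁) (toℕ i₂) (suc B) k p
          ≡⟨ splitLeft-glue πv≗π tops p p<2+B ⟩
        entry ρ p ∎)
      (entry-injective _ _ λ q q<2+s → trans (entry-tabulateℕ (splitRight B (entry πv) (toℕ i₁) (toℕ i₂) (toℕ f₁₊B)) q<2+s (subst (_< 2 + s) (sym (σ-part q q<2+s)) (entry-< σ q)))
                                             (σ-part q q<2+s))
      where
      open ≡-Reasoning
      f₁₊B fₖ : Fin N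
      f₁₊B = fromℕ< 1+B<N
      fₖ   = fromℕ< k<N
      σ-part : AgreeBelow (2 + s) (splitRight B (entry πv) (toℕ i₁) (toℕ i₂) (toℕ f₁₊B)) (entry σ)
      σ-part q q<2+s = trans (cong (λ j → splitRight B (entry πv) (toℕ i₁) (toℕ i₂) j q) (toℕ-fromℕ< 1+B<N))
                             (splitRight-glue πv≗π tops q q<2+s)

    by-occurrences : occurrences321 πv ≡ t₁ ∷ t₂ ∷ [] ⊎ occurrences321 πv ≡ t₂ ∷ t₁ ∷ [] →
                     IsTwoOcc N (suc B) πv × splitWord πv ≡ (ρ , σ)
    by-occurrences (inj₁ occs) = (permutation , _ , _ , _ , _ , _ , _ , occs , letter-middle , letter-middle , refl) ,
                                 trans (splitWord-≡ occs) (splitPair-glue (inj₁ (toℕ-fromℕ< _ , toℕ-fromℕ< _)))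
    by-occurrences (inj₂ occs) = (permutation , _ , _ , _ , _ , _ , _ , occs , letter-middle , letter-middle , refl) ,
                                 trans (splitWord-≡ occs) (splitPair-glue (inj₂ (toℕ-fromℕ< _ , toℕ-fromℕ< _)))

  decWord : ∀ {m} → DecidableEquality (Word m)
  decWord = Vec.≡-dec Fin._≟_

  -- Refinement proofs are irrelevant; word equality is decidable, so the round-trip equations can be recomputed.
  twoOcc⤖rho×sigma : TwoOcc N (suc B) ⤖ (RhoSet (suc B) × SigmaWords (2 + s))
  twoOcc⤖rho×sigma = ↔⇒⤖ (mk↔ₛ′ to from to∘from from∘to)
    where
    to : TwoOcc N (suc B) → RhoSet (suc B) × SigmaWords (2 + s)
    to (π , [ π-ok ]) = (proj₁ (splitWord π) , [ proj₁ (splitWord-correct {π} π-ok) ]) ,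
                        (proj₂ (splitWord π) , [ proj₁ (proj₂ (splitWord-correct {π} π-ok)) ])

    from : RhoSet (suc B) × SigmaWords (2 + s) → TwoOcc N (suc B)
    from ((ρ , [ ρ-ok ]) , (σ , [ σ-ok ])) = glueWord ρ σ , [ proj₁ (glueWord-correct {ρ} {σ} ρ-ok σ-ok) ]

    to∘from : ∀ y → to (from y) ≡ y
    to∘from ((ρ , [ ρ-ok ]) , (σ , [ σ-ok ])) = cong₂ _,_ (value-injective (cong proj₁ split-glue)) (value-injective (cong proj₂ split-glue))
      where
      split-glue : splitWord (glueWord ρ σ) ≡ (ρ , σ)
      split-glue = recompute (Product.≡-dec decWord decWord _ _) (proj₂ (glueWord-correct {ρ} {σ} ρ-ok σ-ok))

    from∘to : ∀ x → from (to x) ≡ x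
    from∘to (π , [ π-ok ]) = value-injective (recompute (decWord _ _) (proj₂ (proj₂ (splitWord-correct {π} π-ok))))

decompose : ∀ {n b} → 1 ≤ b → b < n → ∃ λ B → ∃ λ s → b ≡ suc B × n ≡ suc B + suc s
decompose {n} {suc B} _ b<n = B , n ∸ suc (suc B) , refl , sym (trans (+-suc (suc B) (n ∸ suc (suc B))) (m+[n∸m]≡n b<n))

proposition25 : (n b : ℕ) → 4 ≤ n → 2 ≤ b → b ≤ n ∸ 2 →
    TwoOcc n b ⤖ (RhoSet b × SigmaSet n b)
proposition25 n b 4≤n 2≤b b≤n∸2 with decompose {n} {b} (≤-trans (s≤s z≤n) 2≤b) b<n
  where
  b<n : b < n
  b<n = <-≤-trans (m<m+n b z<s) (subst (b + 2 ≤_) (m∸n+n≡m (≤-trans (s≤s (s≤s z≤n)) 4≤n)) (+-monoˡ-≤ 2 b≤n∸2))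
... | B , s , refl , refl = subst (λ k → TwoOcc (suc B + suc s) (suc B) ⤖ (RhoSet (suc B) × SigmaWords k)) (sym σ-length) (Words.twoOcc⤖rho×sigma B s)
  where
  σ-length : suc B + suc s ∸ suc B + 1 ≡ 2 + s
  σ-length = trans (cong (_+ 1) (m+n∸m≡n (suc B) (suc s))) (+-comm (suc s) 1)
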